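{- Let $q$ and $x$ be indeterminates and $c\ge1$ an integer. Let $D$ be the $q$-differentiation operator on polynomials in $x$, $Df(x)=\frac{f(x)-f(qx)}{(1-q)x}$, and define $\psi_n(x,c)=(x^c+xD)^n\,1$, where $x^c$ acts as multiplication. Then for every $n\ge1$, $$\det\left(\psi_{i+j+1}(x,c)\right)_{i,j=0}^{n-1}=x^{nc}q^{c\binom{n}{2}}\det\left(\psi_{i+j}(x,c)\right)_{i,j=0}^{n-1}.$$ -}

module Defs where

open import Data.Nat as ℕ using (ℕ; zero; suc; _∸_; _≤?_; _≟_)
open import Data.Integer as ℤ using (ℤ; +_)
open import Data.Fin using (Fin; punchIn) renaming (zero to fzero; suc to fsuc)
open import Relation.Nullary using (yes; no)
open import Relation.Binary.PropositionalEquality using (_≡_)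

-- Formal power series in two commuting indeterminates q and x with integer
-- coefficients:  f a b  is the coefficient of  q^a x^b.
-- Polynomials in q, x form a subring of this ring, so all identities between
-- polynomials may be checked here (coefficientwise).
Series : Set
Series = ℕ → ℕ → ℤ

infix 4 _≈_
_≈_ : Series → Series → Set
f ≈ g = ∀ a b → f a b ≡ g a b

zeroS : Series
zeroS _ _ = + 0

mono : ℕ → ℕ → Series
mono e d a b with a ≟ e | b ≟ d
... | yes _ | yes _ = + 1
... | _     | _     = + 0

oneS : Series
oneS = mono 0 0

_+S_ : Series → Series → Series
(f +S g) a b = f a b ℤ.+ g a b

-S_ : Series → Series
(-S f) a b = ℤ.- f a b

_-S_ : Series → Series → Series
f -S g = f +S (-S g)

sumTo : ℕ → (ℕ → ℤ) → ℤ
sumTo zero    h = h 0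
sumTo (suc n) h = sumTo n h ℤ.+ h (suc n)

_*S_ : Series → Series → Series
(f *S g) a b = sumTo a λ i → sumTo b λ j → f i j ℤ.* g (a ∸ i) (b ∸ j)

mulX : Series → Series
mulX f a zero    = + 0
mulX f a (suc b) = f a b

mulXpow : ℕ → Series → Series
mulXpow zero    f = f
mulXpow (suc c) f = mulX (mulXpow c f)

-- division by x (exact on series with vanishing x^0 part)
divX : Series → Series
divX f a b = f a (suc b)

-- f(x) ↦ f(qx): coefficient of q^a x^b in f(qx) is f_{a-b,b} (if b ≤ a)
substQX : Series → Series
substQX f a b with b ≤? a
... | yes _ = f (a ∸ b) b
... | no  _ = + 0

-- 1/(1-q) = Σ_{k ≥ 0} q^k
geomQ : Series
geomQ a zero    = + 1
geomQ a (suc b) = + 0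

qD : Series → Series
qD f = divX (geomQ *S (f -S substQX f))

opψ : ℕ → Series → Series
opψ c f = mulXpow c f +S mulX (qD f)

iter : ℕ → (Series → Series) → Series → Series
iter zero    T f = f
iter (suc n) T f = T (iter n T f)

ψ : ℕ → ℕ → Series
ψ n c = iter n (opψ c) oneS

sumFin : (n : ℕ) → (Fin n → Series) → Series
sumFin zero    h = zeroS
sumFin (suc n) h = h fzero +S sumFin n (λ j → h (fsuc j))

signS : ℕ → Series → Series
signS zero          s = s
signS (suc zero)    s = -S s
signS (suc (suc j)) s = signS j s

det : (n : ℕ) → (Fin n → Fin n → Series) → Series
det zero    M = oneS
det (suc n) M =
  sumFin (suc n) λ j →
    signS (Data.Fin.toℕ j)
      (M fzero j *S det n (λ i k → M (fsuc i) (punchIn j k)))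

module Submission where

-- Put y = xᶜ and p = qᶜ. On x-free multiples of yᵐ the operator xᶜ + xD acts by
-- s yᵐ ↦ s (yᵐ⁺¹ + [mc]_q yᵐ), with [mc]_q = [c]_q [m]_p. Expanding its powers applied
-- to 1 in the Newton basis ∏_{j<k} (t − y pʲ) turns ψ_n into the moments a(n,0) of a
-- Jacobi recurrence a(n+1,k) = a(n,k−1) + b_k a(n,k) + λ_k a(n,k+1). The Hankel matrix
-- then factors as A D Aᵀ with A = (a(i,k)) lower unitriangular and D = diag(λ₀⋯λ_{k−1}),
-- so its determinant is the product of those pivots. The shifted sequence ψ_{n+1} is y
-- times the moments for the weights [(m+1)c]_q, whose pivots are y pᵏ times the old ones;
-- multiplying out gives the factor yⁿ p^(n choose 2).

open import Algebra.Bundles using (CommutativeRing)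

module RangeSum {c ℓ} (R : CommutativeRing c ℓ) where
  open CommutativeRing R
  open import Data.Nat using (ℕ; zero; suc; _∸_; _≤_; z≤n)
  open import Data.Nat.Properties using (≤-refl; m≤n⇒m≤1+n)
  open import Data.Fin using (toℕ)
  open import Algebra.Properties.Semiring.Sum semiring using (sum)
  open import Algebra.Solver.Ring.NaturalCoefficients.Default commutativeSemiring
  open import Relation.Binary.Reasoning.Setoid setoid

  sumTo : ℕ → (ℕ → Carrier) → Carrier
  sumTo zero    h = h 0
  sumTo (suc n) h = sumTo n h + h (suc n)

  sumTo-cong≤ : ∀ n {h g : ℕ → Carrier} → (∀ i → i ≤ n → h i ≈ g i) → sumTo n h ≈ sumTo n g
  sumTo-cong≤ zero    h≈g = h≈g 0 z≤n
  sumTo-cong≤ (suc n) h≈g =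
    +-cong (sumTo-cong≤ n (λ i i≤n → h≈g i (m≤n⇒m≤1+n i≤n))) (h≈g (suc n) ≤-refl)

  sumTo-cong : ∀ n {h g : ℕ → Carrier} → (∀ i → h i ≈ g i) → sumTo n h ≈ sumTo n g
  sumTo-cong n h≈g = sumTo-cong≤ n (λ i _ → h≈g i)

  sumTo-≈0 : ∀ n (h : ℕ → Carrier) → (∀ i → i ≤ n → h i ≈ 0#) → sumTo n h ≈ 0#
  sumTo-≈0 n h h≈0 = trans (sumTo-cong≤ n h≈0) (zeros n)
    where
    zeros : ∀ n → sumTo n (λ _ → 0#) ≈ 0#
    zeros zero    = refl
    zeros (suc n) = trans (+-congʳ (zeros n)) (+-identityʳ 0#)

  sumTo-distrib-+ : ∀ n (h g : ℕ → Carrier) →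
    sumTo n (λ i → h i + g i) ≈ sumTo n h + sumTo n g
  sumTo-distrib-+ zero    h g = refl
  sumTo-distrib-+ (suc n) h g = begin
    sumTo n (λ i → h i + g i) + (h (suc n) + g (suc n))
      ≈⟨ +-congʳ (sumTo-distrib-+ n h g) ⟩
    (sumTo n h + sumTo n g) + (h (suc n) + g (suc n))
      ≈⟨ solve 4 (λ a b c d → (a :+ b) :+ (c :+ d) := (a :+ c) :+ (b :+ d)) refl
           (sumTo n h) (sumTo n g) (h (suc n)) (g (suc n)) ⟩
    (sumTo n h + h (suc n)) + (sumTo n g + g (suc n)) ∎

  *-distribˡ-sumTo : ∀ n a (h : ℕ → Carrier) → a * sumTo n h ≈ sumTo n (λ i → a * h i)
  *-distribˡ-sumTo zero    a h = refl
  *-distribˡ-sumTo (suc n) a h = trans (distribˡ a _ _) (+-congʳ (*-distribˡ-sumTo n a h))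

  *-distribʳ-sumTo : ∀ n a (h : ℕ → Carrier) → sumTo n h * a ≈ sumTo n (λ i → h i * a)
  *-distribʳ-sumTo n a h =
    trans (*-comm _ a) (trans (*-distribˡ-sumTo n a h) (sumTo-cong n (λ i → *-comm a (h i))))

  sumTo-suc : ∀ n (h : ℕ → Carrier) → sumTo (suc n) h ≈ h 0 + sumTo n (λ i → h (suc i))
  sumTo-suc zero    h = refl
  sumTo-suc (suc n) h = trans (+-congʳ (sumTo-suc n h)) (+-assoc _ _ _)

  sumTo-reverse : ∀ n (h : ℕ → Carrier) → sumTo n h ≈ sumTo n (λ i → h (n ∸ i))
  sumTo-reverse zero    h = refl
  sumTo-reverse (suc n) h = begin
    sumTo n h + h (suc n)                  ≈⟨ +-comm _ _ ⟩
    h (suc n) + sumTo n h                  ≈⟨ +-congˡ (sumTo-reverse n h) ⟩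
    h (suc n) + sumTo n (λ i → h (n ∸ i))  ≈⟨ sumTo-suc n (λ i → h (suc n ∸ i)) ⟨
    sumTo (suc n) (λ i → h (suc n ∸ i))    ∎

  sumTo-triangle : ∀ a (F : ℕ → ℕ → Carrier) →
    sumTo a (λ i → sumTo (a ∸ i) (F i)) ≈ sumTo a (λ k → sumTo k (λ i → F i (k ∸ i)))
  sumTo-triangle zero    F = refl
  sumTo-triangle (suc a) F = begin
    sumTo (suc a) (λ i → sumTo (suc a ∸ i) (F i))
      ≈⟨ sumTo-suc a _ ⟩
    sumTo (suc a) (F 0) + sumTo a (λ i → sumTo (a ∸ i) (F (suc i)))
      ≈⟨ +-cong (sumTo-suc a (F 0)) (sumTo-triangle a (λ i → F (suc i))) ⟩
    (F 0 0 + sumTo a (λ k → F 0 (suc k))) + sumTo a (λ k → sumTo k (λ i → F (suc i) (k ∸ i)))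
      ≈⟨ +-assoc _ _ _ ⟩
    F 0 0 + (sumTo a (λ k → F 0 (suc k)) + sumTo a (λ k → sumTo k (λ i → F (suc i) (k ∸ i))))
      ≈⟨ +-congˡ (sumTo-distrib-+ a _ _) ⟨
    F 0 0 + sumTo a (λ k → F 0 (suc k) + sumTo k (λ i → F (suc i) (k ∸ i)))
      ≈⟨ +-congˡ (sumTo-cong a (λ k → sumTo-suc k (λ i → F i (suc k ∸ i)))) ⟨
    F 0 0 + sumTo a (λ k → sumTo (suc k) (λ i → F i (suc k ∸ i)))
      ≈⟨ sumTo-suc a _ ⟨
    sumTo (suc a) (λ k → sumTo k (λ i → F i (k ∸ i))) ∎

  sum-toℕ≈sumTo : ∀ n (h : ℕ → Carrier) → sum {suc n} (λ k → h (toℕ k)) ≈ sumTo n h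
  sum-toℕ≈sumTo zero    h = +-identityʳ _
  sum-toℕ≈sumTo (suc n) h =
    trans (+-congˡ (sum-toℕ≈sumTo n (λ k → h (suc k)))) (sym (sumTo-suc n h))

module PowerSeries {c ℓ} (R : CommutativeRing c ℓ) where
  open import Data.Nat using (ℕ; zero; suc; _∸_; _≤_)
  open import Data.Nat.Properties using (m∸[m∸n]≡n; ∸-+-assoc; m+[n∸m]≡n)
  open import Data.Product using (_,_)
  open import Algebra.Structures using (IsCommutativeRing)
  open import Relation.Binary.PropositionalEquality as ≡ using (_≡_; cong)
  module R = CommutativeRing R
  open R using (Carrier; 0#; 1#)
  open RangeSum R
  open import Relation.Binary.Reasoning.Setoid R.setoid

  Series : Set c
  Series = ℕ → Carrier

  infix 4 _≈_
  _≈_ : Series → Series → Set ℓ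
  f ≈ g = ∀ a → f a R.≈ g a

  _+_ _*_ : Series → Series → Series
  (f + g) a = f a R.+ g a
  (f * g) a = sumTo a (λ i → f i R.* g (a ∸ i))

  -_ : Series → Series
  (- f) a = R.- f a

  0ₛ 1ₛ : Series
  0ₛ _ = 0#
  1ₛ zero    = 1#
  1ₛ (suc _) = 0#

  *-comm : ∀ f g → f * g ≈ g * f
  *-comm f g a = begin
    sumTo a (λ i → f i R.* g (a ∸ i))              ≈⟨ sumTo-reverse a _ ⟩
    sumTo a (λ i → f (a ∸ i) R.* g (a ∸ (a ∸ i)))  ≈⟨ sumTo-cong≤ a swap ⟩
    sumTo a (λ i → g i R.* f (a ∸ i))              ∎
    where
    swap : ∀ i → i ≤ a → f (a ∸ i) R.* g (a ∸ (a ∸ i)) R.≈ g i R.* f (a ∸ i)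
    swap i i≤a = R.trans (R.*-comm _ _) (R.reflexive (cong (λ t → g t R.* f (a ∸ i)) (m∸[m∸n]≡n i≤a)))

  *-assoc : ∀ f g h → (f * g) * h ≈ f * (g * h)
  *-assoc f g h a = R.sym (begin
    sumTo a (λ i → f i R.* sumTo (a ∸ i) (λ j → g j R.* h (a ∸ i ∸ j)))
      ≈⟨ sumTo-cong a (λ i → *-distribˡ-sumTo (a ∸ i) (f i) _) ⟩
    sumTo a (λ i → sumTo (a ∸ i) (λ j → f i R.* (g j R.* h (a ∸ i ∸ j))))
      ≈⟨ sumTo-triangle a (λ i j → f i R.* (g j R.* h (a ∸ i ∸ j))) ⟩
    sumTo a (λ k → sumTo k (λ i → f i R.* (g (k ∸ i) R.* h (a ∸ i ∸ (k ∸ i)))))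
      ≈⟨ sumTo-cong a (λ k → sumTo-cong≤ k (λ i i≤k →
           R.trans (R.sym (R.*-assoc _ _ _)) (R.reflexive (cong (λ t → (f i R.* g (k ∸ i)) R.* h t) (∸-∸-cancel i≤k))))) ⟩
    sumTo a (λ k → sumTo k (λ i → (f i R.* g (k ∸ i)) R.* h (a ∸ k)))
      ≈⟨ sumTo-cong a (λ k → *-distribʳ-sumTo k _ _) ⟨
    sumTo a (λ k → sumTo k (λ i → f i R.* g (k ∸ i)) R.* h (a ∸ k)) ∎)
    where
    ∸-∸-cancel : ∀ {i k} → i ≤ k → a ∸ i ∸ (k ∸ i) ≡ a ∸ k
    ∸-∸-cancel {i} {k} i≤k = ≡.trans (∸-+-assoc a i (k ∸ i)) (cong (a ∸_) (m+[n∸m]≡n i≤k))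

  *-identityˡ : ∀ f → 1ₛ * f ≈ f
  *-identityˡ f zero    = R.*-identityˡ _
  *-identityˡ f (suc a) = begin
    sumTo (suc a) (λ i → 1ₛ i R.* f (suc a ∸ i))               ≈⟨ sumTo-suc a _ ⟩
    1# R.* f (suc a) R.+ sumTo a (λ i → 0# R.* f (a ∸ i))       ≈⟨ R.+-cong (R.*-identityˡ _) (sumTo-≈0 a _ (λ i _ → R.zeroˡ _)) ⟩
    f (suc a) R.+ 0#                                            ≈⟨ R.+-identityʳ _ ⟩
    f (suc a)                                                   ∎

  distribʳ : ∀ h f g → (f + g) * h ≈ (f * h) + (g * h)
  distribʳ h f g a = R.trans (sumTo-cong a (λ i → R.distribʳ _ _ _)) (sumTo-distrib-+ a _ _)

  *-cong : ∀ {f f′ g g′} → f ≈ f′ → g ≈ g′ → f * g ≈ f′ * g′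
  *-cong f≈f′ g≈g′ a = sumTo-cong a (λ i → R.*-cong (f≈f′ i) (g≈g′ (a ∸ i)))

  isCommutativeRing : IsCommutativeRing _≈_ _+_ _*_ -_ 0ₛ 1ₛ
  isCommutativeRing = record
    { isRing = record
      { +-isAbelianGroup = record
        { isGroup = record
          { isMonoid = record
            { isSemigroup = record
              { isMagma = record
                { isEquivalence = record
                  { refl = λ a → R.refl ; sym = λ e a → R.sym (e a) ; trans = λ e e′ a → R.trans (e a) (e′ a) }
                ; ∙-cong = λ e e′ a → R.+-cong (e a) (e′ a) }
              ; assoc = λ f g h a → R.+-assoc _ _ _ }
            ; identity = (λ f a → R.+-identityˡ _) , (λ f a → R.+-identityʳ _) }
          ; inverse = (λ f a → R.-‿inverseˡ _) , (λ f a → R.-‿inverseʳ _)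
          ; ⁻¹-cong = λ e a → R.-‿cong (e a) }
        ; comm = λ f g a → R.+-comm _ _ }
      ; *-cong = *-cong
      ; *-assoc = *-assoc
      ; *-identity = *-identityˡ , (λ f a → R.trans (*-comm f 1ₛ a) (*-identityˡ f a))
      ; distrib = (λ h f g a → R.trans (*-comm h _ a) (R.trans (distribʳ h f g a) (R.+-cong (*-comm f h a) (*-comm g h a))))
                , distribʳ }
    ; *-comm = *-comm }

  commutativeRing : CommutativeRing c ℓ
  commutativeRing = record { isCommutativeRing = isCommutativeRing }

module QInteger {c ℓ} (R : CommutativeRing c ℓ) (q : CommutativeRing.Carrier R) where
  open CommutativeRing R
  open import Data.Nat using (ℕ; zero; suc)
  open import Algebra.Bundles using (Semiring)
  open import Algebra.Definitions.RawSemiring (Semiring.rawSemiring semiring) public using (_^_)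
  open import Algebra.Solver.Ring.NaturalCoefficients.Default commutativeSemiring
  open import Relation.Binary.Reasoning.Setoid setoid

  [_] : ℕ → Carrier
  [ zero  ] = 0#
  [ suc m ] = 1# + q * [ m ]

  [_]-geometric : ∀ m → (1# - q) * [ m ] + q ^ m ≈ 1#
  [ zero  ]-geometric = trans (+-congʳ (zeroʳ _)) (+-identityˡ 1#)
  [ suc m ]-geometric = begin
    (1# - q) * (1# + q * [ m ]) + q * q ^ m
      ≈⟨ solve 4 (λ o q n r → o :* (con 1 :+ q :* n) :+ q :* r := o :+ q :* (o :* n :+ r)) refl (1# - q) q [ m ] (q ^ m) ⟩
    (1# - q) + q * ((1# - q) * [ m ] + q ^ m)
      ≈⟨ +-congˡ (trans (*-congˡ [ m ]-geometric) (*-identityʳ q)) ⟩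
    (1# - q) + q
      ≈⟨ trans (+-assoc _ _ _) (trans (+-congˡ (-‿inverseˡ q)) (+-identityʳ 1#)) ⟩
    1# ∎

module Products {c ℓ} (R : CommutativeRing c ℓ) where
  open CommutativeRing R
  open import Data.Nat as ℕ using (ℕ; zero; suc)
  open import Data.Nat.Combinatorics using (_C_; nCk+nC[k+1]≡[n+1]C[k+1]; nC1≡n)
  open import Data.Fin using (toℕ)
  open import Relation.Binary.PropositionalEquality as ≡ using (_≡_)
  open import Algebra.Bundles using (Semiring)
  open import Algebra.Definitions.RawSemiring (Semiring.rawSemiring semiring) using (_^_)
  open import Algebra.Properties.Semiring.Exp semiring using (^-homo-*)
  open import Algebra.Properties.CommutativeMonoid.Sum *-commutativeMonoid public
    using () renaming (sum to product; sum-cong-≋ to product-cong; ∑-distrib-+ to product-distrib-*)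
  open import Relation.Binary.Reasoning.Setoid setoid

  product-const : ∀ n x → product {n} (λ _ → x) ≈ x ^ n
  product-const zero    x = refl
  product-const (suc n) x = *-congˡ (product-const n x)

  [n+1]C2≡n+nC2 : ∀ n → suc n C 2 ≡ n ℕ.+ n C 2
  [n+1]C2≡n+nC2 n = ≡.trans (≡.sym (nCk+nC[k+1]≡[n+1]C[k+1] n 1)) (≡.cong (ℕ._+ n C 2) (nC1≡n n))

  product-^ : ∀ n x → product {n} (λ k → x ^ toℕ k) ≈ x ^ (n C 2)
  product-^ zero    x = refl
  product-^ (suc n) x = begin
    1# * product {n} (λ k → x * x ^ toℕ k)                ≈⟨ *-identityˡ _ ⟩
    product {n} (λ k → x * x ^ toℕ k)                     ≈⟨ product-distrib-* {n} (λ _ → x) (λ k → x ^ toℕ k) ⟩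
    product {n} (λ _ → x) * product {n} (λ k → x ^ toℕ k) ≈⟨ *-cong (product-const n x) (product-^ n x) ⟩
    x ^ n * x ^ (n C 2)                                   ≈⟨ ^-homo-* x n (n C 2) ⟨
    x ^ (n ℕ.+ n C 2)                                     ≡⟨ ≡.cong (x ^_) ([n+1]C2≡n+nC2 n) ⟨
    x ^ (suc n C 2)                                       ∎

module Determinant {c ℓ} (R : CommutativeRing c ℓ) where
  open CommutativeRing R hiding (zero)
  open import Data.Nat as ℕ using (ℕ; zero; suc)
  import Data.Nat.Properties as ℕ
  open import Data.Fin using (Fin; zero; suc; toℕ; fromℕ<; punchIn; punchOut; _≟_)
  open import Data.Fin.Properties using (punchInᵢ≢i; punchOut-cong; punchOut-punchIn; suc-injective; toℕ-injective; toℕ<n; toℕ-fromℕ<)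
  open import Data.Vec.Functional using (Vector; updateAt)
  open import Data.Vec.Functional.Properties using (updateAt-updates; updateAt-minimal; updateAt-id-local)
  open import Data.Vec.Functional.Relation.Binary.Equality.Setoid setoid using (_≋_; ≋-refl; ≋-reflexive; ≋-sym; ≋-trans)
  open import Data.Sum using (_⊎_; inj₁; inj₂)
  open import Function using (_∘_; const)
  open import Level using (_⊔_)
  open import Relation.Nullary using (yes; no; contradiction)
  open import Relation.Binary.PropositionalEquality as ≡ using (_≡_; _≢_)
  open import Algebra.Properties.Ring ring using (-‿involutive; -‿distribˡ-*; -‿distribʳ-*; -0#≈0#; -‿+-comm)
  open import Algebra.Properties.Semiring.Sum semiring
  open Products R using (product)
  open import Algebra.Solver.Ring.NaturalCoefficients.Default commutativeSemiring
  open import Relation.Binary.Reasoning.Setoid setoid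

  Matrix : ℕ → Set c
  Matrix n = Fin n → Fin n → Carrier

  sign : ℕ → Carrier
  sign zero    = 1#
  sign (suc k) = - sign k

  sign-+ : ∀ k l → sign (k ℕ.+ l) ≈ sign k * sign l
  sign-+ zero    l = sym (*-identityˡ _)
  sign-+ (suc k) l = trans (-‿cong (sign-+ k l)) (-‿distribˡ-* _ _)

  minor : ∀ {n} → Matrix (suc n) → Fin (suc n) → Matrix n
  minor M j i k = M (suc i) (punchIn j k)

  det : ∀ n → Matrix n → Carrier
  det zero    M = 1#
  det (suc n) M = ∑[ j < suc n ] (sign (toℕ j) * (M zero j * det n (minor M j)))

  det-cong : ∀ n {M N : Matrix n} → (∀ i → M i ≋ N i) → det n M ≈ det n N
  det-cong zero    M≋N = refl
  det-cong (suc n) M≋N = sum-cong-≋ λ j →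
    *-congˡ {sign (toℕ j)} (*-cong (M≋N zero j) (det-cong n (λ i k → M≋N (suc i) (punchIn j k))))

  -‿sum : ∀ {n} (f : Vector Carrier n) → ∑[ i < n ] (- f i) ≈ - sum f
  -‿sum {zero}  f = sym -0#≈0#
  -‿sum {suc n} f = trans (+-congˡ (-‿sum (f ∘ suc))) (-‿+-comm _ _)

  sum-≈0 : ∀ {n} (f : Vector Carrier n) → (∀ i → f i ≈ 0#) → sum f ≈ 0#
  sum-≈0 {n} f f≈0 = trans (sum-cong-≋ f≈0) (sum-replicate-zero n)

  sum-single : ∀ {n} (i : Fin (suc n)) (f : Vector Carrier (suc n)) →
    (∀ j → j ≢ i → f j ≈ 0#) → sum f ≈ f i
  sum-single {n} i f f≈0 = begin
    sum f                                 ≈⟨ sum-remove {i = i} f ⟩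
    f i + ∑[ k < n ] f (punchIn i k)      ≈⟨ +-congˡ (sum-≈0 _ (λ k → f≈0 _ (punchInᵢ≢i i k))) ⟩
    f i + 0#                              ≈⟨ +-identityʳ _ ⟩
    f i                                   ∎

  ∑-factor : ∀ {m n} (cs : Vector Carrier m) (T : Fin n → Fin m → Carrier) →
    ∑[ j < n ] ∑[ k < m ] (cs k * T j k) ≈ ∑[ k < m ] (cs k * ∑[ j < n ] T j k)
  ∑-factor cs T = trans (∑-comm (λ j k → cs k * T j k)) (sum-cong-≋ (λ k → sym (*-distribˡ-sum (cs k) (λ j → T j k))))

  scale-∑ˡ : ∀ {m} a b (cs xs : Vector Carrier m) →
    a * (∑[ k < m ] (cs k * xs k) * b) ≈ ∑[ k < m ] (cs k * (a * (xs k * b)))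
  scale-∑ˡ {m} a b cs xs = begin
    a * (∑[ k < m ] (cs k * xs k) * b)        ≈⟨ *-congˡ (*-distribʳ-sum b (λ k → cs k * xs k)) ⟩
    a * ∑[ k < m ] (cs k * xs k * b)          ≈⟨ *-distribˡ-sum a (λ k → cs k * xs k * b) ⟩
    ∑[ k < m ] (a * (cs k * xs k * b))        ≈⟨ sum-cong-≋ (λ k → solve 4 (λ a b c x → a :* (c :* x :* b) := c :* (a :* (x :* b)))
                                                                  refl a b (cs k) (xs k)) ⟩
    ∑[ k < m ] (cs k * (a * (xs k * b)))      ∎

  scale-∑ʳ : ∀ {m} a x (cs ys : Vector Carrier m) →
    a * (x * ∑[ k < m ] (cs k * ys k)) ≈ ∑[ k < m ] (cs k * (a * (x * ys k)))
  scale-∑ʳ {m} a x cs ys = begin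
    a * (x * ∑[ k < m ] (cs k * ys k))        ≈⟨ *-congˡ (*-comm x (∑[ k < m ] (cs k * ys k))) ⟩
    a * (∑[ k < m ] (cs k * ys k) * x)        ≈⟨ scale-∑ˡ a x cs ys ⟩
    ∑[ k < m ] (cs k * (a * (ys k * x)))      ≈⟨ sum-cong-≋ (λ k → *-congˡ {cs k} (*-congˡ {a} (*-comm (ys k) x))) ⟩
    ∑[ k < m ] (cs k * (a * (x * ys k)))      ∎

  det-linear : ∀ n {m} (r : Fin n) (M : Matrix n) (Ms : Fin m → Matrix n) (cs : Vector Carrier m) →
    (∀ k i → i ≢ r → Ms k i ≋ M i) → M r ≋ (λ l → ∑[ k < m ] (cs k * Ms k r l)) →
    det n M ≈ ∑[ k < m ] (cs k * det n (Ms k))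
  det-linear (suc n) {m} zero M Ms cs same row = begin
    ∑[ j < suc n ] (sign (toℕ j) * (M zero j * det n (minor M j)))
      ≈⟨ sum-cong-≋ expand ⟩
    ∑[ j < suc n ] ∑[ k < m ] (cs k * (sign (toℕ j) * (Ms k zero j * det n (minor (Ms k) j))))
      ≈⟨ ∑-factor cs (λ j k → sign (toℕ j) * (Ms k zero j * det n (minor (Ms k) j))) ⟩
    ∑[ k < m ] (cs k * det (suc n) (Ms k)) ∎
    where
    expand : ∀ j → sign (toℕ j) * (M zero j * det n (minor M j))
                   ≈ ∑[ k < m ] (cs k * (sign (toℕ j) * (Ms k zero j * det n (minor (Ms k) j))))
    expand j = begin
      sign (toℕ j) * (M zero j * det n (minor M j))
        ≈⟨ *-congˡ {sign (toℕ j)} (*-congʳ (row j)) ⟩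
      sign (toℕ j) * (∑[ k < m ] (cs k * Ms k zero j) * det n (minor M j))
        ≈⟨ scale-∑ˡ _ _ cs (λ k → Ms k zero j) ⟩
      ∑[ k < m ] (cs k * (sign (toℕ j) * (Ms k zero j * det n (minor M j))))
        ≈⟨ sum-cong-≋ (λ k → *-congˡ {cs k} (*-congˡ {sign (toℕ j)} (*-congˡ {Ms k zero j}
             (det-cong n (λ i l → sym (same k (suc i) (λ ()) (punchIn j l))))))) ⟩
      ∑[ k < m ] (cs k * (sign (toℕ j) * (Ms k zero j * det n (minor (Ms k) j)))) ∎
  det-linear (suc n) {m} (suc r) M Ms cs same row = begin
    ∑[ j < suc n ] (sign (toℕ j) * (M zero j * det n (minor M j)))
      ≈⟨ sum-cong-≋ (λ j → *-congˡ {sign (toℕ j)} (*-congˡ {M zero j} (det-linear n r (minor M j) (λ k → minor (Ms k) j) cs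
           (λ k i i≢r l → same k (suc i) (i≢r ∘ suc-injective) (punchIn j l)) (row ∘ punchIn j)))) ⟩
    ∑[ j < suc n ] (sign (toℕ j) * (M zero j * ∑[ k < m ] (cs k * det n (minor (Ms k) j))))
      ≈⟨ sum-cong-≋ (λ j → trans (scale-∑ʳ _ _ cs (λ k → det n (minor (Ms k) j)))
           (sum-cong-≋ (λ k → *-congˡ {cs k} (*-congˡ {sign (toℕ j)} (*-congʳ (sym (same k zero (λ ()) j))))))) ⟩
    ∑[ j < suc n ] ∑[ k < m ] (cs k * (sign (toℕ j) * (Ms k zero j * det n (minor (Ms k) j))))
      ≈⟨ ∑-factor cs (λ j k → sign (toℕ j) * (Ms k zero j * det n (minor (Ms k) j))) ⟩
    ∑[ k < m ] (cs k * det (suc n) (Ms k)) ∎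

  punchOut-parity : ∀ {n} (a b : Fin (suc n)) (a≢b : a ≢ b) (b≢a : b ≢ a) →
    suc (toℕ a ℕ.+ toℕ (punchOut a≢b)) ≡ toℕ b ℕ.+ toℕ (punchOut b≢a) ⊎
    toℕ a ℕ.+ toℕ (punchOut a≢b) ≡ suc (toℕ b ℕ.+ toℕ (punchOut b≢a))
  punchOut-parity zero zero a≢b _ = contradiction ≡.refl a≢b
  punchOut-parity {suc n} zero (suc b) _ _ = inj₁ (≡.cong suc (≡.sym (ℕ.+-identityʳ (toℕ b))))
  punchOut-parity {suc n} (suc a) zero _ _ = inj₂ (≡.cong suc (ℕ.+-identityʳ (toℕ a)))
  punchOut-parity {suc n} (suc a) (suc b) a≢b b≢a
    with punchOut-parity a b (a≢b ∘ ≡.cong suc) (b≢a ∘ ≡.cong suc)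
  ... | inj₁ e = inj₁ (≡.trans (≡.cong (λ t → suc (suc t)) (ℕ.+-suc (toℕ a) _))
                         (≡.trans (≡.cong (λ t → suc (suc t)) e) (≡.cong suc (≡.sym (ℕ.+-suc (toℕ b) _)))))
  ... | inj₂ e = inj₂ (≡.trans (≡.cong suc (ℕ.+-suc (toℕ a) _))
                         (≡.trans (≡.cong (λ t → suc (suc t)) e) (≡.cong (λ t → suc (suc t)) (≡.sym (ℕ.+-suc (toℕ b) _)))))

  sign-punchOut : ∀ {n} (a b : Fin (suc n)) (a≢b : a ≢ b) (b≢a : b ≢ a) →
    sign (toℕ a) * sign (toℕ (punchOut a≢b)) ≈ - (sign (toℕ b) * sign (toℕ (punchOut b≢a)))
  sign-punchOut a b a≢b b≢a with punchOut-parity a b a≢b b≢a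
  ... | inj₁ e = begin
    sign (toℕ a) * sign (toℕ (punchOut a≢b))    ≈⟨ sign-+ (toℕ a) _ ⟨
    sign (toℕ a ℕ.+ toℕ (punchOut a≢b))         ≈⟨ -‿involutive _ ⟨
    sign (suc (suc (toℕ a ℕ.+ toℕ (punchOut a≢b)))) ≡⟨ ≡.cong (λ t → sign (suc t)) e ⟩
    - sign (toℕ b ℕ.+ toℕ (punchOut b≢a))       ≈⟨ -‿cong (sign-+ (toℕ b) _) ⟩
    - (sign (toℕ b) * sign (toℕ (punchOut b≢a))) ∎
  ... | inj₂ e = begin
    sign (toℕ a) * sign (toℕ (punchOut a≢b))    ≈⟨ sign-+ (toℕ a) _ ⟨
    sign (toℕ a ℕ.+ toℕ (punchOut a≢b))         ≡⟨ ≡.cong sign e ⟩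
    - sign (toℕ b ℕ.+ toℕ (punchOut b≢a))       ≈⟨ -‿cong (sign-+ (toℕ b) _) ⟩
    - (sign (toℕ b) * sign (toℕ (punchOut b≢a))) ∎

  punchIn-punchOut-comm : ∀ {n} (a b : Fin (suc (suc n))) (a≢b : a ≢ b) (b≢a : b ≢ a) (l : Fin n) →
    punchIn a (punchIn (punchOut a≢b) l) ≡ punchIn b (punchIn (punchOut b≢a) l)
  punchIn-punchOut-comm zero zero a≢b _ l = contradiction ≡.refl a≢b
  punchIn-punchOut-comm zero (suc b) _ _ l = ≡.refl
  punchIn-punchOut-comm (suc a) zero _ _ l = ≡.refl
  punchIn-punchOut-comm {suc n} (suc a) (suc b) _ _ zero = ≡.refl
  punchIn-punchOut-comm {suc n} (suc a) (suc b) a≢b b≢a (suc l) =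
    ≡.cong suc (punchIn-punchOut-comm a b (a≢b ∘ ≡.cong suc) (b≢a ∘ ≡.cong suc) l)

  -- The term of det M that takes column a from row 0 and column b from row 1.
  pairTerm : ∀ {n} → Matrix (suc (suc n)) → Fin (suc (suc n)) → Fin (suc (suc n)) → Carrier
  pairTerm {n} M a b with a ≟ b
  ... | yes _   = 0#
  ... | no a≢b  = sign (toℕ a) * sign (toℕ (punchOut a≢b))
                  * (M zero a * (M (suc zero) b * det n (minor (minor M a) (punchOut a≢b))))

  pairTerm-diagonal : ∀ {n} (M : Matrix (suc (suc n))) a → pairTerm M a a ≈ 0#
  pairTerm-diagonal M a with a ≟ a
  ... | yes _   = refl
  ... | no a≢a  = contradiction ≡.refl a≢a

  pairTerm-punchIn : ∀ {n} (M : Matrix (suc (suc n))) a k →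
    pairTerm M a (punchIn a k) ≈ sign (toℕ a) * sign (toℕ k)
      * (M zero a * (M (suc zero) (punchIn a k) * det n (minor (minor M a) k)))
  pairTerm-punchIn M a k with a ≟ punchIn a k
  ... | yes a≡ = contradiction (≡.sym a≡) (punchInᵢ≢i a k)
  ... | no a≢ rewrite ≡.trans (punchOut-cong a {i≢j = a≢} {i≢k = punchInᵢ≢i a k ∘ ≡.sym} ≡.refl)
                               (punchOut-punchIn a {k}) = refl

  det-expand₀₁ : ∀ {n} (M : Matrix (suc (suc n))) →
    det (suc (suc n)) M ≈ ∑[ a < suc (suc n) ] ∑[ b < suc (suc n) ] pairTerm M a b
  det-expand₀₁ {n} M = sum-cong-≋ expand
    where
    D : Fin (suc (suc n)) → Fin (suc n) → Carrier
    D a k = M (suc zero) (punchIn a k) * det n (minor (minor M a) k)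
    expand : ∀ a → sign (toℕ a) * (M zero a * det (suc n) (minor M a)) ≈ ∑[ b < suc (suc n) ] pairTerm M a b
    expand a = begin
      sign (toℕ a) * (M zero a * ∑[ k < suc n ] (sign (toℕ k) * D a k))
        ≈⟨ *-congˡ {sign (toℕ a)} (*-distribˡ-sum (M zero a) (λ k → sign (toℕ k) * D a k)) ⟩
      sign (toℕ a) * ∑[ k < suc n ] (M zero a * (sign (toℕ k) * D a k))
        ≈⟨ *-distribˡ-sum (sign (toℕ a)) (λ k → M zero a * (sign (toℕ k) * D a k)) ⟩
      ∑[ k < suc n ] (sign (toℕ a) * (M zero a * (sign (toℕ k) * D a k)))
        ≈⟨ sum-cong-≋ (λ k → trans (solve 5 (λ s x t y d → s :* (x :* (t :* (y :* d))) := s :* t :* (x :* (y :* d))) refl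
                                      (sign (toℕ a)) (M zero a) (sign (toℕ k)) (M (suc zero) (punchIn a k)) (det n (minor (minor M a) k)))
                                    (sym (pairTerm-punchIn M a k))) ⟩
      ∑[ k < suc n ] pairTerm M a (punchIn a k)
        ≈⟨ +-identityˡ _ ⟨
      0# + ∑[ k < suc n ] pairTerm M a (punchIn a k)
        ≈⟨ +-congʳ (pairTerm-diagonal M a) ⟨
      pairTerm M a a + ∑[ k < suc n ] pairTerm M a (punchIn a k)
        ≈⟨ sum-remove {i = a} (pairTerm M a) ⟨
      ∑[ b < suc (suc n) ] pairTerm M a b ∎

  record IsRowSwap {n} (M M′ : Matrix n) (r s : Fin n) : Set (c ⊔ ℓ) where
    field
      at-r      : M′ r ≋ M s
      at-s      : M′ s ≋ M r
      elsewhere : ∀ i → i ≢ r → i ≢ s → M′ i ≋ M i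

  IsRowSwap-sym : ∀ {n} {M M′ : Matrix n} {r s} → IsRowSwap M M′ r s → IsRowSwap M M′ s r
  IsRowSwap-sym sw = record { at-r = at-s ; at-s = at-r ; elsewhere = λ i i≢s i≢r → elsewhere i i≢r i≢s }
    where open IsRowSwap sw

  swapRows : ∀ {n} → Matrix n → Fin n → Fin n → Matrix n
  swapRows M r s = updateAt (updateAt M r (const (M s))) s (const (M r))

  swapRows-isRowSwap : ∀ {n} (M : Matrix n) {r s} → r ≢ s → IsRowSwap M (swapRows M r s) r s
  swapRows-isRowSwap M {r} {s} r≢s = record
    { at-r      = ≋-reflexive (≡.trans (updateAt-minimal r s _ r≢s) (updateAt-updates r M))
    ; at-s      = ≋-reflexive (updateAt-updates s _)
    ; elsewhere = λ i i≢r i≢s → ≋-reflexive (≡.trans (updateAt-minimal i s _ i≢s) (updateAt-minimal i r M i≢r))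
    }

  pairTerm-antisym : ∀ {n} {M M′ : Matrix (suc (suc n))} → IsRowSwap M M′ zero (suc zero) →
    ∀ a b → pairTerm M′ a b ≈ - pairTerm M b a
  pairTerm-antisym {n} {M} {M′} sw a b with a ≟ b | b ≟ a
  ... | yes _   | yes _   = sym -0#≈0#
  ... | yes a≡b | no b≢a  = contradiction (≡.sym a≡b) b≢a
  ... | no a≢b  | yes b≡a = contradiction (≡.sym b≡a) a≢b
  ... | no a≢b  | no b≢a  = begin
    sign (toℕ a) * sign (toℕ (punchOut a≢b)) * (M′ zero a * (M′ (suc zero) b * det n (minor (minor M′ a) (punchOut a≢b))))
      ≈⟨ *-congˡ {sign (toℕ a) * sign (toℕ (punchOut a≢b))} (*-cong (at-r a) (*-cong (at-s b) (det-cong n same-minor))) ⟩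
    sign (toℕ a) * sign (toℕ (punchOut a≢b)) * (M (suc zero) a * (M zero b * det n (minor (minor M b) (punchOut b≢a))))
      ≈⟨ *-cong (sign-punchOut a b a≢b b≢a) (solve 3 (λ x y d → x :* (y :* d) := y :* (x :* d)) refl _ _ _) ⟩
    - (sign (toℕ b) * sign (toℕ (punchOut b≢a))) * (M zero b * (M (suc zero) a * det n (minor (minor M b) (punchOut b≢a))))
      ≈⟨ -‿distribˡ-* _ _ ⟨
    - (sign (toℕ b) * sign (toℕ (punchOut b≢a)) * (M zero b * (M (suc zero) a * det n (minor (minor M b) (punchOut b≢a))))) ∎
    where
    open IsRowSwap sw
    same-minor : ∀ i → minor (minor M′ a) (punchOut a≢b) i ≋ minor (minor M b) (punchOut b≢a) i
    same-minor i l = trans (elsewhere (suc (suc i)) (λ ()) (λ ()) _)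
                           (reflexive (≡.cong (M (suc (suc i))) (punchIn-punchOut-comm a b a≢b b≢a l)))

  det-swap₀₁ : ∀ {n} {M M′ : Matrix (suc (suc n))} → IsRowSwap M M′ zero (suc zero) →
    det (suc (suc n)) M′ ≈ - det (suc (suc n)) M
  det-swap₀₁ {n} {M} {M′} sw = begin
    det N M′                                  ≈⟨ det-expand₀₁ M′ ⟩
    ∑[ a < N ] ∑[ b < N ] pairTerm M′ a b     ≈⟨ sum-cong-≋ (λ a → sum-cong-≋ (pairTerm-antisym sw a)) ⟩
    ∑[ a < N ] ∑[ b < N ] (- pairTerm M b a)  ≈⟨ sum-cong-≋ (λ a → -‿sum (λ b → pairTerm M b a)) ⟩
    ∑[ a < N ] (- ∑[ b < N ] pairTerm M b a)  ≈⟨ -‿sum (λ a → ∑[ b < N ] pairTerm M b a) ⟩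
    - ∑[ a < N ] ∑[ b < N ] pairTerm M b a    ≈⟨ -‿cong (∑-comm (λ a b → pairTerm M b a)) ⟩
    - ∑[ b < N ] ∑[ a < N ] pairTerm M b a    ≈⟨ -‿cong (det-expand₀₁ M) ⟨
    - det N M                                 ∎
    where
    N : ℕ
    N = suc (suc n)

  det-swap : ∀ n {M M′ : Matrix n} {r s} → r ≢ s → IsRowSwap M M′ r s → det n M′ ≈ - det n M

  det-swap-tail : ∀ n {M M′ : Matrix (suc n)} {r s : Fin n} → r ≢ s →
    IsRowSwap M M′ (suc r) (suc s) → det (suc n) M′ ≈ - det (suc n) M
  det-swap-tail n {M} {M′} {r} {s} r≢s sw = begin
    ∑[ j < suc n ] (sign (toℕ j) * (M′ zero j * det n (minor M′ j)))
      ≈⟨ sum-cong-≋ (λ j → *-congˡ {sign (toℕ j)} (*-cong (elsewhere zero (λ ()) (λ ()) j) (det-swap n r≢s (swap-minor j)))) ⟩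
    ∑[ j < suc n ] (sign (toℕ j) * (M zero j * - det n (minor M j)))
      ≈⟨ sum-cong-≋ (λ j → trans (*-congˡ {sign (toℕ j)} (sym (-‿distribʳ-* (M zero j) (det n (minor M j)))))
                                 (sym (-‿distribʳ-* (sign (toℕ j)) _))) ⟩
    ∑[ j < suc n ] (- (sign (toℕ j) * (M zero j * det n (minor M j))))
      ≈⟨ -‿sum (λ j → sign (toℕ j) * (M zero j * det n (minor M j))) ⟩
    - det (suc n) M ∎
    where
    open IsRowSwap sw
    swap-minor : ∀ j → IsRowSwap (minor M j) (minor M′ j) r s
    swap-minor j = record
      { at-r      = at-r ∘ punchIn j
      ; at-s      = at-s ∘ punchIn j
      ; elsewhere = λ i i≢r i≢s → elsewhere (suc i) (i≢r ∘ suc-injective) (i≢s ∘ suc-injective) ∘ punchIn j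
      }

  -- Exchanging rows 0 and s+2 is the composite of the exchanges (1 s+2), (0 1), (1 s+2).
  det-swap-head : ∀ n {M M′ : Matrix (suc n)} (s : Fin n) →
    IsRowSwap M M′ zero (suc s) → det (suc n) M′ ≈ - det (suc n) M
  det-swap-head (suc n) zero sw = det-swap₀₁ sw
  det-swap-head (suc n) {M} {M′} (suc t) sw = begin
    det (suc (suc n)) M′          ≈⟨ det-swap-tail (suc n) (λ ()) swB′ ⟩
    - det (suc (suc n)) B         ≈⟨ -‿cong (det-swap₀₁ swB) ⟩
    - - det (suc (suc n)) A       ≈⟨ -‿involutive _ ⟩
    det (suc (suc n)) A           ≈⟨ det-swap-tail (suc n) (λ ()) swA ⟩
    - det (suc (suc n)) M         ∎
    where
    S : Fin (suc (suc n))
    S = suc (suc t)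
    A B : Matrix (suc (suc n))
    A = swapRows M (suc zero) S
    B = swapRows A zero (suc zero)
    swA : IsRowSwap M A (suc zero) S
    swA = swapRows-isRowSwap M (λ ())
    swB : IsRowSwap A B zero (suc zero)
    swB = swapRows-isRowSwap A (λ ())
    module M′ = IsRowSwap sw
    module A = IsRowSwap swA
    module B = IsRowSwap swB
    swB′ : IsRowSwap B M′ (suc zero) S
    swB′ = record
      { at-r      = ≋-trans (M′.elsewhere (suc zero) (λ ()) (λ ())) (≋-sym (≋-trans (B.elsewhere S (λ ()) (λ ())) A.at-s))
      ; at-s      = ≋-trans M′.at-s (≋-sym (≋-trans B.at-s (A.elsewhere zero (λ ()) (λ ()))))
      ; elsewhere = others
      }
      where
      others : ∀ i → i ≢ suc zero → i ≢ S → M′ i ≋ B i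
      others zero    _   _   = ≋-trans M′.at-r (≋-sym (≋-trans B.at-r A.at-r))
      others (suc i) i≢1 i≢S = ≋-trans (M′.elsewhere (suc i) (λ ()) i≢S)
                                       (≋-sym (≋-trans (B.elsewhere (suc i) (λ ()) i≢1) (A.elsewhere (suc i) i≢1 i≢S)))

  det-swap (suc n) {r = zero}  {zero}  r≢s _  = contradiction ≡.refl r≢s
  det-swap (suc n) {r = zero}  {suc s} _   sw = det-swap-head n s sw
  det-swap (suc n) {r = suc r} {zero}  _   sw = det-swap-head n r (IsRowSwap-sym sw)
  det-swap (suc n) {r = suc r} {suc s} r≢s sw = det-swap-tail n (r≢s ∘ ≡.cong suc) sw

  det-first-column-zero : ∀ n (M : Matrix (suc n)) → (∀ i → M i zero ≈ 0#) → det (suc n) M ≈ 0#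

  det-minor-first-column-zero : ∀ {n} (M : Matrix (suc n)) (j : Fin n) →
    (∀ i → M (suc i) zero ≈ 0#) → det n (minor M (suc j)) ≈ 0#
  det-minor-first-column-zero {suc n} M j M·0≈0 = det-first-column-zero n (minor M (suc j)) M·0≈0

  det-first-column-zero n M M·0≈0 = sum-≈0 _ term≈0
    where
    term≈0 : ∀ j → sign (toℕ j) * (M zero j * det n (minor M j)) ≈ 0#
    term≈0 zero    = trans (*-congˡ {1#} (trans (*-congʳ (M·0≈0 zero)) (zeroˡ _))) (zeroʳ _)
    term≈0 (suc j) = trans (*-congˡ {sign (toℕ (suc j))} (trans (*-congˡ {M zero (suc j)}
                       (det-minor-first-column-zero M j (M·0≈0 ∘ suc))) (zeroʳ _))) (zeroʳ _)

  det-upper-triangular : ∀ n (U : Matrix n) → (∀ i j → toℕ j ℕ.< toℕ i → U i j ≈ 0#) →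
    det n U ≈ product (λ i → U i i)
  det-upper-triangular zero    U lower = refl
  det-upper-triangular (suc n) U lower = begin
    1# * (U zero zero * det n (minor U zero)) + ∑[ j < n ] (sign (suc (toℕ j)) * (U zero (suc j) * det n (minor U (suc j))))
      ≈⟨ +-cong (*-identityˡ _) (sum-≈0 _ term≈0) ⟩
    U zero zero * det n (minor U zero) + 0#
      ≈⟨ +-identityʳ _ ⟩
    U zero zero * det n (minor U zero)
      ≈⟨ *-congˡ {U zero zero} (det-upper-triangular n (minor U zero) (λ i j j<i → lower (suc i) (suc j) (ℕ.s≤s j<i))) ⟩
    product (λ i → U i i) ∎
    where
    term≈0 : ∀ j → sign (suc (toℕ j)) * (U zero (suc j) * det n (minor U (suc j))) ≈ 0#
    term≈0 j = trans (*-congˡ {sign (suc (toℕ j))} (trans (*-congˡ {U zero (suc j)}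
                 (det-minor-first-column-zero U j (λ i → lower (suc i) zero (ℕ.s≤s ℕ.z≤n)))) (zeroʳ _))) (zeroʳ _)

  record IsLowerUnitriangular {n} (L : Matrix n) : Set ℓ where
    field
      diagonal : ∀ i → L i i ≈ 1#
      above    : ∀ i k → toℕ i ℕ.< toℕ k → L i k ≈ 0#

  mixRows : ∀ {n} → ℕ → Matrix n → Matrix n → Matrix n
  mixRows t M H i with t ℕ.≤? toℕ i
  ... | yes _ = H i
  ... | no _  = M i

  mixRows-zero : ∀ {n} (M H : Matrix n) i → mixRows 0 M H i ≋ H i
  mixRows-zero M H i with 0 ℕ.≤? toℕ i
  ... | yes _  = ≋-refl
  ... | no 0≰i = contradiction ℕ.z≤n 0≰i

  mixRows-below : ∀ {n t} (M H : Matrix n) → n ℕ.≤ t → ∀ i → mixRows t M H i ≋ M i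
  mixRows-below {t = t} M H n≤t i with t ℕ.≤? toℕ i
  ... | yes t≤i = contradiction (ℕ.≤-trans n≤t t≤i) (ℕ.<⇒≱ (toℕ<n i))
  ... | no _    = ≋-refl

  -- Alternation is obtained from the sign change under row swaps, which needs 2 to be cancellable.
  module _ (x+x≈0⇒x≈0 : ∀ x → x + x ≈ 0# → x ≈ 0#) where

    det-equal-rows : ∀ n (M : Matrix n) {r s} → r ≢ s → M r ≋ M s → det n M ≈ 0#
    det-equal-rows n M {r} {s} r≢s Mr≋Ms = x+x≈0⇒x≈0 _ (begin
      det n M + det n M    ≈⟨ +-congˡ (det-swap n r≢s swap-equal) ⟩
      det n M + - det n M  ≈⟨ -‿inverseʳ _ ⟩
      0#                   ∎)
      where
      swap-equal : IsRowSwap M M r s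
      swap-equal = record { at-r = Mr≋Ms ; at-s = ≋-sym Mr≋Ms ; elsewhere = λ _ _ _ → ≋-refl }

    det-row-combination : ∀ n (M N : Matrix n) (t : Fin n) (cs : Vector Carrier n) →
      (∀ i → i ≢ t → M i ≋ N i) → M t ≋ (λ l → ∑[ k < n ] (cs k * N k l)) →
      det n M ≈ cs t * det n N
    det-row-combination (suc n) M N t cs same row = begin
      det (suc n) M                                        ≈⟨ det-linear (suc n) t M Nₖ cs same′ row′ ⟩
      ∑[ k < suc n ] (cs k * det (suc n) (Nₖ k))           ≈⟨ sum-single t _ other ⟩
      cs t * det (suc n) (Nₖ t)                            ≈⟨ *-congˡ {cs t} (det-cong (suc n) (λ i → ≋-reflexive (updateAt-id-local t N ≡.refl i))) ⟩
      cs t * det (suc n) N                                 ∎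
      where
      Nₖ : Fin (suc n) → Matrix (suc n)
      Nₖ k = updateAt N t (const (N k))
      at-t : ∀ k → Nₖ k t ≡ N k
      at-t k = updateAt-updates t N
      off-t : ∀ k {i} → i ≢ t → Nₖ k i ≡ N i
      off-t k i≢t = updateAt-minimal _ t N i≢t
      same′ : ∀ k i → i ≢ t → Nₖ k i ≋ M i
      same′ k i i≢t = ≋-trans (≋-reflexive (off-t k i≢t)) (≋-sym (same i i≢t))
      row′ : M t ≋ (λ l → ∑[ k < suc n ] (cs k * Nₖ k t l))
      row′ l = trans (row l) (sum-cong-≋ (λ k → *-congˡ {cs k} (reflexive (≡.cong (λ v → v l) (≡.sym (at-t k))))))
      other : ∀ k → k ≢ t → cs k * det (suc n) (Nₖ k) ≈ 0#
      other k k≢t = trans (*-congˡ {cs k} (det-equal-rows (suc n) (Nₖ k) (k≢t ∘ ≡.sym)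
                      (≋-reflexive (≡.trans (at-t k) (≡.sym (off-t k k≢t)))))) (zeroʳ _)

    module _ {n} {L M H : Matrix n} (L-unitriangular : IsLowerUnitriangular L)
             (H≈LM : ∀ i j → H i j ≈ ∑[ k < n ] (L i k * M k j)) where
      open IsLowerUnitriangular L-unitriangular

      -- Row t of H is row t of M plus multiples of the rows of M above it.
      det-mixRows-suc : ∀ t → t ℕ.< n → det n (mixRows t M H) ≈ det n (mixRows (suc t) M H)
      det-mixRows-suc t t<n = begin
        det n (mixRows t M H)                 ≈⟨ det-row-combination n _ _ t′ (L t′) same row ⟩
        L t′ t′ * det n (mixRows (suc t) M H) ≈⟨ trans (*-congʳ (diagonal t′)) (*-identityˡ _) ⟩
        det n (mixRows (suc t) M H)           ∎
        where
        t′ : Fin n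
        t′ = fromℕ< t<n
        same : ∀ i → i ≢ t′ → mixRows t M H i ≋ mixRows (suc t) M H i
        same i i≢t′ with t ℕ.≤? toℕ i | suc t ℕ.≤? toℕ i
        ... | yes _   | yes _     = ≋-refl
        ... | yes t≤i | no 1+t≰i  =
          contradiction (toℕ-injective (≡.trans (ℕ.≤-antisym (ℕ.≮⇒≥ 1+t≰i) t≤i) (≡.sym (toℕ-fromℕ< t<n)))) i≢t′
        ... | no t≰i  | yes 1+t≤i = contradiction (ℕ.<⇒≤ 1+t≤i) t≰i
        ... | no _    | no _      = ≋-refl
        at-t′ : mixRows t M H t′ ≋ H t′
        at-t′ with t ℕ.≤? toℕ t′
        ... | yes _   = ≋-refl
        ... | no t≰t′ = contradiction (ℕ.≤-reflexive (≡.sym (toℕ-fromℕ< t<n))) t≰t′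
        term : ∀ k l → L t′ k * M k l ≈ L t′ k * mixRows (suc t) M H k l
        term k l with suc t ℕ.≤? toℕ k
        ... | yes t<k = trans (trans (*-congʳ L≈0) (zeroˡ _)) (sym (trans (*-congʳ L≈0) (zeroˡ _)))
          where
          L≈0 : L t′ k ≈ 0#
          L≈0 = above t′ k (≡.subst (ℕ._< toℕ k) (≡.sym (toℕ-fromℕ< t<n)) t<k)
        ... | no _    = refl
        row : mixRows t M H t′ ≋ (λ l → ∑[ k < n ] (L t′ k * mixRows (suc t) M H k l))
        row l = trans (at-t′ l) (trans (H≈LM t′ l) (sum-cong-≋ (λ k → term k l)))

      det-mixRows : ∀ u t → u ℕ.+ t ≡ n → det n (mixRows t M H) ≈ det n M
      det-mixRows zero    t t≡n   = det-cong n (mixRows-below M H (ℕ.≤-reflexive (≡.sym t≡n)))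
      det-mixRows (suc u) t u+t≡n = trans (det-mixRows-suc t (≡.subst (t ℕ.<_) u+t≡n (ℕ.s≤s (ℕ.m≤n+m t u))))
                                          (det-mixRows u (suc t) (≡.trans (ℕ.+-suc u t) u+t≡n))

      det-unitriangular-mul : det n H ≈ det n M
      det-unitriangular-mul = trans (det-cong n (λ i → ≋-sym (mixRows-zero M H i))) (det-mixRows n 0 (ℕ.+-identityʳ n))

module MotzkinMoments {c ℓ} (R : CommutativeRing c ℓ) (y p : CommutativeRing.Carrier R) where
  open CommutativeRing R hiding (zero)
  open import Data.Nat as ℕ using (ℕ; zero; suc; _<_; _≤_; z≤n; s≤s)
  import Data.Nat.Properties as ℕ
  open import Data.Fin using (Fin; toℕ)
  open import Data.Fin.Properties using (toℕ<n)
  import Relation.Binary.PropositionalEquality as ≡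
  open QInteger R p using ([_]; _^_)
  open import Algebra.Solver.Ring.NaturalCoefficients.Default commutativeSemiring
  open import Relation.Binary.Reasoning.Setoid setoid
  open RangeSum R
  open import Algebra.Properties.Semiring.Sum semiring using (sum-syntax)
  open Products R using (product; product-cong)
  open Determinant R using (det; IsLowerUnitriangular; det-unitriangular-mul; det-upper-triangular)

  *-≈0ʳ : ∀ {x z} → z ≈ 0# → x * z ≈ 0#
  *-≈0ʳ z≈0 = trans (*-congˡ z≈0) (zeroʳ _)

  *-≈0ˡ : ∀ {x z} → x ≈ 0# → x * z ≈ 0#
  *-≈0ˡ x≈0 = trans (*-congʳ x≈0) (zeroˡ _)

  shift : (ℕ → Carrier) → ℕ → Carrier
  shift f zero    = 0#
  shift f (suc k) = f k

  -- The coordinates of tᵐ in the Newton basis ∏_{j<k} (t − y pʲ), so that pascal m 0 = yᵐ.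
  pascal : ℕ → ℕ → Carrier
  pascal zero    zero    = 1#
  pascal zero    (suc k) = 0#
  pascal (suc m) zero    = y * pascal m zero
  pascal (suc m) (suc k) = pascal m k + y * p ^ suc k * pascal m (suc k)

  pascal-suc : ∀ m k → pascal (suc m) k ≈ shift (pascal m) k + y * p ^ k * pascal m k
  pascal-suc m zero    = solve 2 (λ y x → y :* x := con 0 :+ y :* con 1 :* x) refl y (pascal m zero)
  pascal-suc m (suc k) = refl

  [_]-pascal : ∀ m k → [ m ] * pascal m k ≈ [ k ] * pascal m k + y * p ^ k * [ suc k ] * pascal m (suc k)
  [ zero ]-pascal zero = solve 2 (λ y p → con 0 :* con 1 := con 0 :* con 1 :+ y :* con 1 :* (con 1 :+ p :* con 0) :* con 0) refl y p
  [ zero ]-pascal (suc k) = solve 4 (λ y n₁ q n₂ → con 0 :* con 0 := n₁ :* con 0 :+ y :* q :* n₂ :* con 0) refl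
    y [ suc k ] (p ^ suc k) [ suc (suc k) ]
  [ suc m ]-pascal zero = begin
    (1# + p * [ m ]) * (y * pascal m 0)
      ≈⟨ solve 4 (λ p n y x → (con 1 :+ p :* n) :* (y :* x) := y :* x :+ p :* y :* (n :* x)) refl p [ m ] y (pascal m 0) ⟩
    y * pascal m 0 + p * y * ([ m ] * pascal m 0)
      ≈⟨ +-congˡ (*-congˡ ([ m ]-pascal zero)) ⟩
    y * pascal m 0 + p * y * (0# * pascal m 0 + y * 1# * (1# + p * 0#) * pascal m 1)
      ≈⟨ solve 4 (λ p y x₀ x₁ → y :* x₀ :+ p :* y :* (con 0 :* x₀ :+ y :* con 1 :* (con 1 :+ p :* con 0) :* x₁)
                        := con 0 :* (y :* x₀) :+ y :* con 1 :* (con 1 :+ p :* con 0) :* (x₀ :+ y :* (p :* con 1) :* x₁))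
              refl p y (pascal m 0) (pascal m 1) ⟩
    0# * (y * pascal m 0) + y * 1# * (1# + p * 0#) * (pascal m 0 + y * (p * 1#) * pascal m 1) ∎
  [ suc m ]-pascal (suc k) = begin
    (1# + p * [ m ]) * (x₀ + y * (p * q) * x₁)
      ≈⟨ solve 6 (λ p n y q x₀ x₁ → (con 1 :+ p :* n) :* (x₀ :+ y :* (p :* q) :* x₁)
            := x₀ :+ p :* (n :* x₀) :+ y :* (p :* q) :* x₁ :+ p :* y :* (p :* q) :* (n :* x₁)) refl p [ m ] y q x₀ x₁ ⟩
    x₀ + p * ([ m ] * x₀) + y * (p * q) * x₁ + p * y * (p * q) * ([ m ] * x₁)
      ≈⟨ +-cong (+-congʳ (+-congˡ (*-congˡ ([ m ]-pascal k)))) (*-congˡ ([ m ]-pascal (suc k))) ⟩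
    x₀ + p * ([ k ] * x₀ + y * q * [ suc k ] * x₁) + y * (p * q) * x₁
      + p * y * (p * q) * ([ suc k ] * x₁ + y * (p * q) * [ suc (suc k) ] * x₂)
      ≈⟨ solve 7 (λ p n y q x₀ x₁ x₂ →
            x₀ :+ p :* (n :* x₀ :+ y :* q :* (con 1 :+ p :* n) :* x₁) :+ y :* (p :* q) :* x₁
             :+ p :* y :* (p :* q) :* ((con 1 :+ p :* n) :* x₁ :+ y :* (p :* q) :* (con 1 :+ p :* (con 1 :+ p :* n)) :* x₂)
            := (con 1 :+ p :* n) :* (x₀ :+ y :* (p :* q) :* x₁)
             :+ y :* (p :* q) :* (con 1 :+ p :* (con 1 :+ p :* n)) :* (x₁ :+ y :* (p :* (p :* q)) :* x₂))
            refl p [ k ] y q x₀ x₁ x₂ ⟩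
    (1# + p * [ k ]) * (x₀ + y * (p * q) * x₁)
      + y * (p * q) * (1# + p * (1# + p * [ k ])) * (x₁ + y * (p * (p * q)) * x₂) ∎
    where
    q x₀ x₁ x₂ : Carrier
    q = p ^ k
    x₀ = pascal m k
    x₁ = pascal m (suc k)
    x₂ = pascal m (suc (suc k))

  module Weighted (α β d₀ : Carrier) where

    weight : ℕ → Carrier
    weight m = α + β * [ m ]

    b Λ : ℕ → Carrier
    b k = y * p ^ k + weight k
    Λ k = y * p ^ k * β * [ suc k ]

    pascal-recurrence : ∀ m k → pascal (suc m) k + weight m * pascal m k
                                ≈ shift (pascal m) k + b k * pascal m k + Λ k * pascal m (suc k)
    pascal-recurrence m k = begin
      pascal (suc m) k + (α + β * [ m ]) * pascal m k
        ≈⟨ +-cong (pascal-suc m k) (solve 4 (λ a b n x → (a :+ b :* n) :* x := a :* x :+ b :* (n :* x)) refl α β [ m ] (pascal m k)) ⟩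
      (shift (pascal m) k + y * p ^ k * pascal m k) + (α * pascal m k + β * ([ m ] * pascal m k))
        ≈⟨ +-congˡ (+-congˡ (*-congˡ ([ m ]-pascal k))) ⟩
      (shift (pascal m) k + y * p ^ k * pascal m k) + (α * pascal m k + β * ([ k ] * pascal m k + y * p ^ k * [ suc k ] * pascal m (suc k)))
        ≈⟨ solve 9 (λ s y q x a b n n₁ x₁ → (s :+ y :* q :* x) :+ (a :* x :+ b :* (n :* x :+ y :* q :* n₁ :* x₁))
              := s :+ (y :* q :+ (a :+ b :* n)) :* x :+ y :* q :* b :* n₁ :* x₁) refl
              (shift (pascal m) k) y (p ^ k) (pascal m k) α β [ k ] [ suc k ] (pascal m (suc k)) ⟩
      shift (pascal m) k + b k * pascal m k + Λ k * pascal m (suc k) ∎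

    -- The coordinates of Tⁱ 1 in the basis tᵐ, for T tᵐ = tᵐ⁺¹ + weight m · tᵐ.
    stirling : ℕ → ℕ → Carrier
    stirling zero    zero    = 1#
    stirling zero    (suc m) = 0#
    stirling (suc i) zero    = weight 0 * stirling i 0
    stirling (suc i) (suc m) = stirling i m + weight (suc m) * stirling i (suc m)

    stirling-above-diagonal : ∀ i m → i < m → stirling i m ≈ 0#
    stirling-above-diagonal zero    (suc m) _ = refl
    stirling-above-diagonal (suc i) (suc m) (s≤s i<m) =
      trans (+-cong (stirling-above-diagonal i m i<m)
                    (*-≈0ʳ (stirling-above-diagonal i (suc m) (ℕ.m<n⇒m<1+n i<m))))
            (+-identityʳ _)

    sumTo-stirling-suc : ∀ i (e : ℕ → Carrier) →
      sumTo (suc i) (λ m → stirling (suc i) m * e m) ≈ sumTo i (λ m → stirling i m * (e (suc m) + weight m * e m))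
    sumTo-stirling-suc i e = begin
      sumTo (suc i) (λ m → stirling (suc i) m * e m)
        ≈⟨ sumTo-suc i _ ⟩
      weight 0 * S i 0 * e 0 + sumTo i (λ m → (S i m + weight (suc m) * S i (suc m)) * e (suc m))
        ≈⟨ +-congˡ (trans (sumTo-cong i (λ m → distribʳ _ _ _)) (sumTo-distrib-+ i _ _)) ⟩
      weight 0 * S i 0 * e 0 + (sumTo i (λ m → S i m * e (suc m)) + sumTo i (λ m → weight (suc m) * S i (suc m) * e (suc m)))
        ≈⟨ solve 3 (λ a b c → a :+ (b :+ c) := b :+ (a :+ c)) refl _ _ _ ⟩
      sumTo i (λ m → S i m * e (suc m)) + (weight 0 * S i 0 * e 0 + sumTo i (λ m → weight (suc m) * S i (suc m) * e (suc m)))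
        ≈⟨ +-congˡ (sumTo-suc i (λ m → weight m * S i m * e m)) ⟨
      sumTo i (λ m → S i m * e (suc m)) + (sumTo i (λ m → weight m * S i m * e m) + weight (suc i) * S i (suc i) * e (suc i))
        ≈⟨ +-congˡ (trans (+-congˡ top≈0) (+-identityʳ _)) ⟩
      sumTo i (λ m → S i m * e (suc m)) + sumTo i (λ m → weight m * S i m * e m)
        ≈⟨ sumTo-distrib-+ i _ _ ⟨
      sumTo i (λ m → S i m * e (suc m) + weight m * S i m * e m)
        ≈⟨ sumTo-cong i (λ m → solve 4 (λ s a w x → s :* a :+ w :* s :* x := s :* (a :+ w :* x)) refl (S i m) (e (suc m)) (weight m) (e m)) ⟩
      sumTo i (λ m → stirling i m * (e (suc m) + weight m * e m)) ∎
      where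
      S : ℕ → ℕ → Carrier
      S = stirling
      top≈0 : weight (suc i) * S i (suc i) * e (suc i) ≈ 0#
      top≈0 = *-≈0ˡ (*-≈0ʳ (stirling-above-diagonal i (suc i) ℕ.≤-refl))

    -- The Newton coordinates of Tⁱ 1; by pascal-recurrence, T is tridiagonal in the Newton basis.
    motzkin : ℕ → ℕ → Carrier
    motzkin i k = sumTo i (λ m → stirling i m * pascal m k)

    jacobi : (ℕ → Carrier) → ℕ → Carrier
    jacobi u k = shift u k + b k * u k + Λ k * u (suc k)

    motzkin-suc : ∀ i k → motzkin (suc i) k ≈ jacobi (motzkin i) k
    motzkin-suc i k = begin
      motzkin (suc i) k
        ≈⟨ sumTo-stirling-suc i (λ m → pascal m k) ⟩
      sumTo i (λ m → S i m * (pascal (suc m) k + weight m * pascal m k))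
        ≈⟨ sumTo-cong i (λ m → *-congˡ (pascal-recurrence m k)) ⟩
      sumTo i (λ m → S i m * (shift (pascal m) k + b k * pascal m k + Λ k * pascal m (suc k)))
        ≈⟨ sumTo-cong i (λ m → solve 6 (λ s x b y l z → s :* (x :+ b :* y :+ l :* z) := s :* x :+ b :* (s :* y) :+ l :* (s :* z)) refl
              (S i m) (shift (pascal m) k) (b k) (pascal m k) (Λ k) (pascal m (suc k))) ⟩
      sumTo i (λ m → S i m * shift (pascal m) k + b k * (S i m * pascal m k) + Λ k * (S i m * pascal m (suc k)))
        ≈⟨ trans (sumTo-distrib-+ i _ _) (+-congʳ (sumTo-distrib-+ i _ _)) ⟩
      sumTo i (λ m → S i m * shift (pascal m) k) + sumTo i (λ m → b k * (S i m * pascal m k)) + sumTo i (λ m → Λ k * (S i m * pascal m (suc k)))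
        ≈⟨ +-cong (+-cong (sumTo-shift k) (*-distribˡ-sumTo i (b k) _)) (*-distribˡ-sumTo i (Λ k) _) ⟨
      shift (motzkin i) k + b k * motzkin i k + Λ k * motzkin i (suc k) ∎
      where
      S : ℕ → ℕ → Carrier
      S = stirling
      sumTo-shift : ∀ k → shift (motzkin i) k ≈ sumTo i (λ m → S i m * shift (pascal m) k)
      sumTo-shift zero    = sym (sumTo-≈0 i _ (λ m _ → zeroʳ _))
      sumTo-shift (suc k) = refl

    motzkin-above-diagonal : ∀ i k → i < k → motzkin i k ≈ 0#
    motzkin-above-diagonal zero (suc k) _ = *-identityˡ _
    motzkin-above-diagonal (suc i) (suc k) (s≤s i<k) = trans (motzkin-suc i (suc k)) (begin
      motzkin i k + b (suc k) * motzkin i (suc k) + Λ (suc k) * motzkin i (suc (suc k))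
        ≈⟨ +-cong (+-cong (motzkin-above-diagonal i k i<k) (*-≈0ʳ (motzkin-above-diagonal i (suc k) (ℕ.m<n⇒m<1+n i<k))))
                  (*-≈0ʳ (motzkin-above-diagonal i (suc (suc k)) (ℕ.m<n⇒m<1+n (ℕ.m<n⇒m<1+n i<k)))) ⟩
      0# + 0# + 0#
        ≈⟨ solve 0 (con 0 :+ con 0 :+ con 0 := con 0) refl ⟩
      0# ∎)

    motzkin-diagonal : ∀ i → motzkin i i ≈ 1#
    motzkin-diagonal zero    = *-identityˡ _
    motzkin-diagonal (suc i) = trans (motzkin-suc i (suc i)) (begin
      motzkin i i + b (suc i) * motzkin i (suc i) + Λ (suc i) * motzkin i (suc (suc i))
        ≈⟨ +-cong (+-cong (motzkin-diagonal i) (*-≈0ʳ (motzkin-above-diagonal i (suc i) ℕ.≤-refl)))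
                  (*-≈0ʳ (motzkin-above-diagonal i (suc (suc i)) (ℕ.m<n⇒m<1+n ℕ.≤-refl))) ⟩
      1# + 0# + 0#
        ≈⟨ solve 0 (con 1 :+ con 0 :+ con 0 := con 1) refl ⟩
      1# ∎)


    pivot : ℕ → Carrier
    pivot zero    = d₀
    pivot (suc k) = Λ k * pivot k

    pairing : ℕ → (ℕ → Carrier) → (ℕ → Carrier) → Carrier
    pairing K u v = sumTo K (λ k → u k * (v k * pivot k))

    sumTo-by-parts : ∀ K (f g : ℕ → Carrier) →
      sumTo K (λ k → shift f k * g k) + f K * g (suc K) ≈ sumTo K (λ k → f k * g (suc k))
    sumTo-by-parts zero    f g = trans (+-congʳ (zeroˡ _)) (+-identityˡ _)
    sumTo-by-parts (suc K) f g = +-congʳ (sumTo-by-parts K f g)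

    -- Λ k * pivot k = pivot (suc k) makes the Jacobi operator self-adjoint for the pairing.
    jacobi-self-adjoint : ∀ K u v → u K ≈ 0# → u (suc K) ≈ 0# → pairing K (jacobi u) v ≈ pairing K u (jacobi v)
    jacobi-self-adjoint K u v uK≈0 uK+1≈0 = begin
      sumTo K (λ k → (shift u k + b k * u k + Λ k * u (suc k)) * (v k * pivot k))
        ≈⟨ sumTo-cong K (λ k → solve 7 (λ s b u l w v d → (s :+ b :* u :+ l :* w) :* (v :* d)
                                          := s :* (v :* d) :+ b :* u :* (v :* d) :+ (v :* (l :* d)) :* w) refl
                           (shift u k) (b k) (u k) (Λ k) (u (suc k)) (v k) (pivot k)) ⟩
      sumTo K (λ k → shift u k * (v k * pivot k) + b k * u k * (v k * pivot k) + (v k * pivot (suc k)) * u (suc k))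
        ≈⟨ trans (sumTo-distrib-+ K _ _) (+-congʳ (sumTo-distrib-+ K _ _)) ⟩
      sumTo K (λ k → shift u k * (v k * pivot k)) + sumTo K (λ k → b k * u k * (v k * pivot k)) + sumTo K (λ k → (v k * pivot (suc k)) * u (suc k))
        ≈⟨ +-cong (+-cong lower-diagonal refl) upper-diagonal ⟩
      sumTo K (λ k → u k * (v (suc k) * pivot (suc k))) + sumTo K (λ k → b k * u k * (v k * pivot k)) + sumTo K (λ k → u k * (shift v k * pivot k))
        ≈⟨ trans (sumTo-distrib-+ K _ _) (+-congʳ (sumTo-distrib-+ K _ _)) ⟨
      sumTo K (λ k → u k * (v (suc k) * pivot (suc k)) + b k * u k * (v k * pivot k) + u k * (shift v k * pivot k))
        ≈⟨ sumTo-cong K (λ k → solve 7 (λ u w l d b v s → u :* (w :* (l :* d)) :+ b :* u :* (v :* d) :+ u :* (s :* d)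
                                          := u :* ((s :+ b :* v :+ l :* w) :* d)) refl
                           (u k) (v (suc k)) (Λ k) (pivot k) (b k) (v k) (shift v k)) ⟩
      sumTo K (λ k → u k * ((shift v k + b k * v k + Λ k * v (suc k)) * pivot k)) ∎
      where
      lower-diagonal : sumTo K (λ k → shift u k * (v k * pivot k)) ≈ sumTo K (λ k → u k * (v (suc k) * pivot (suc k)))
      lower-diagonal = trans (sym (trans (+-congˡ (*-≈0ˡ uK≈0)) (+-identityʳ _))) (sumTo-by-parts K u (λ k → v k * pivot k))
      shifted : ∀ k → shift (λ k → v k * pivot (suc k)) k * u k ≈ u k * (shift v k * pivot k)
      shifted zero    = trans (zeroˡ _) (sym (*-≈0ʳ (zeroˡ _)))
      shifted (suc k) = *-comm _ _
      upper-diagonal : sumTo K (λ k → (v k * pivot (suc k)) * u (suc k)) ≈ sumTo K (λ k → u k * (shift v k * pivot k))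
      upper-diagonal = begin
        sumTo K (λ k → (v k * pivot (suc k)) * u (suc k))
          ≈⟨ sumTo-by-parts K (λ k → v k * pivot (suc k)) u ⟨
        sumTo K (λ k → shift (λ k → v k * pivot (suc k)) k * u k) + (v K * pivot (suc K)) * u (suc K)
          ≈⟨ trans (+-congˡ (*-≈0ʳ uK+1≈0)) (+-identityʳ _) ⟩
        sumTo K (λ k → shift (λ k → v k * pivot (suc k)) k * u k)
          ≈⟨ sumTo-cong K shifted ⟩
        sumTo K (λ k → u k * (shift v k * pivot k)) ∎

    pairing-motzkin-zero : ∀ K j → pairing K (motzkin 0) (motzkin j) ≈ motzkin j 0 * d₀
    pairing-motzkin-zero zero    j = trans (*-congʳ (motzkin-diagonal 0)) (*-identityˡ _)
    pairing-motzkin-zero (suc K) j = begin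
      pairing (suc K) (motzkin 0) (motzkin j)
        ≈⟨ sumTo-suc K _ ⟩
      motzkin 0 0 * (motzkin j 0 * d₀) + sumTo K (λ k → motzkin 0 (suc k) * (motzkin j (suc k) * pivot (suc k)))
        ≈⟨ +-cong (trans (*-congʳ (motzkin-diagonal 0)) (*-identityˡ _))
                  (sumTo-≈0 K _ (λ k _ → *-≈0ˡ (motzkin-above-diagonal 0 (suc k) (s≤s z≤n)))) ⟩
      motzkin j 0 * d₀ + 0#  ≈⟨ +-identityʳ _ ⟩
      motzkin j 0 * d₀       ∎

    pairing-motzkin : ∀ K i j → i ≤ K → pairing K (motzkin i) (motzkin j) ≈ motzkin (i ℕ.+ j) 0 * d₀
    pairing-motzkin K zero    j _   = pairing-motzkin-zero K j
    pairing-motzkin K (suc i) j i<K = begin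
      pairing K (motzkin (suc i)) (motzkin j)   ≈⟨ sumTo-cong K (λ k → *-congʳ (motzkin-suc i k)) ⟩
      pairing K (jacobi (motzkin i)) (motzkin j) ≈⟨ jacobi-self-adjoint K (motzkin i) (motzkin j)
                                                     (motzkin-above-diagonal i K i<K) (motzkin-above-diagonal i (suc K) (ℕ.m<n⇒m<1+n i<K)) ⟩
      pairing K (motzkin i) (jacobi (motzkin j)) ≈⟨ sumTo-cong K (λ k → *-congˡ (*-congʳ (motzkin-suc j k))) ⟨
      pairing K (motzkin i) (motzkin (suc j))   ≈⟨ pairing-motzkin K i (suc j) (ℕ.<⇒≤ i<K) ⟩
      motzkin (i ℕ.+ suc j) 0 * d₀               ≡⟨ ≡.cong (λ t → motzkin t 0 * d₀) (ℕ.+-suc i j) ⟩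
      motzkin (suc i ℕ.+ j) 0 * d₀               ∎

    det-hankel : (∀ x → x + x ≈ 0# → x ≈ 0#) →
      ∀ n → det n (λ i j → motzkin (toℕ i ℕ.+ toℕ j) 0 * d₀) ≈ product {n} (λ k → pivot (toℕ k))
    det-hankel x+x≈0⇒x≈0 zero    = refl
    det-hankel x+x≈0⇒x≈0 (suc K) = begin
      det (suc K) (λ i j → motzkin (toℕ i ℕ.+ toℕ j) 0 * d₀)
        ≈⟨ det-unitriangular-mul x+x≈0⇒x≈0 {M = U} L-unitriangular hankel≈LU ⟩
      det (suc K) U
        ≈⟨ det-upper-triangular (suc K) U (λ k j j<k → *-≈0ˡ (motzkin-above-diagonal (toℕ j) (toℕ k) j<k)) ⟩
      product {suc K} (λ k → motzkin (toℕ k) (toℕ k) * pivot (toℕ k))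
        ≈⟨ product-cong {suc K} (λ k → trans (*-congʳ (motzkin-diagonal (toℕ k))) (*-identityˡ (pivot (toℕ k)))) ⟩
      product {suc K} (λ k → pivot (toℕ k)) ∎
      where
      L U : Fin (suc K) → Fin (suc K) → Carrier
      L i k = motzkin (toℕ i) (toℕ k)
      L-unitriangular : IsLowerUnitriangular L
      L-unitriangular = record { diagonal = λ i → motzkin-diagonal (toℕ i) ; above = λ i k → motzkin-above-diagonal (toℕ i) (toℕ k) }
      U k j = motzkin (toℕ j) (toℕ k) * pivot (toℕ k)
      hankel≈LU : ∀ i j → motzkin (toℕ i ℕ.+ toℕ j) 0 * d₀ ≈ ∑[ k < suc K ] (L i k * U k j)
      hankel≈LU i j = begin
        motzkin (toℕ i ℕ.+ toℕ j) 0 * d₀                  ≈⟨ pairing-motzkin K (toℕ i) (toℕ j) (ℕ.≤-pred (toℕ<n i)) ⟨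
        pairing K (motzkin (toℕ i)) (motzkin (toℕ j))     ≈⟨ sum-toℕ≈sumTo K _ ⟨
        ∑[ k < suc K ] (L i k * U k j)                    ∎

open import Defs
open import Data.Nat using (ℕ; suc; _+_; _*_; _≤_)
open import Data.Nat.Combinatorics using (_C_)
open import Data.Fin using (Fin; toℕ)

module BivariateSeries where
  open import Data.Nat as ℕ using (ℕ; zero; suc; _∸_; _<_; _≤_; _≟_; _≤?_; z≤n; s≤s)
  import Data.Nat.Properties as ℕ
  open import Data.Integer as ℤ using (ℤ; +_)
  import Data.Integer.Properties as ℤ
  open import Data.Product using (_,_)
  open import Level using (0ℓ)
  open import Relation.Nullary using (yes; no; contradiction)
  open import Function using (_∘_)
  open import Relation.Binary.PropositionalEquality as ≡ using (_≡_; _≢_; refl)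
  import Algebra.Bundles
  open Algebra.Bundles using (CommutativeRing)
  open import Algebra.Structures using (IsCommutativeRing)
  import Algebra.Properties.Ring

  private
    module ℤ[[x]]      = PowerSeries ℤ.+-*-commutativeRing
    module ℤ[[x]][[q]] = PowerSeries ℤ[[x]].commutativeRing
    module ℤΣ          = RangeSum ℤ.+-*-commutativeRing
    module ℤ[[x]]Σ     = RangeSum ℤ[[x]].commutativeRing
    module ℙ = CommutativeRing ℤ[[x]][[q]].commutativeRing

  sumTo-cong : ∀ n {h g : ℕ → ℤ} → (∀ i → h i ≡ g i) → sumTo n h ≡ sumTo n g
  sumTo-cong zero    h≡g = h≡g 0
  sumTo-cong (suc n) h≡g = ≡.cong₂ ℤ._+_ (sumTo-cong n h≡g) (h≡g (suc n))

  ℤΣ-sumTo : ∀ n h → ℤΣ.sumTo n h ≡ sumTo n h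
  ℤΣ-sumTo zero    h = refl
  ℤΣ-sumTo (suc n) h = ≡.cong (ℤ._+ h (suc n)) (ℤΣ-sumTo n h)

  ℤ[[x]]Σ-sumTo : ∀ n (h : ℕ → ℕ → ℤ) b → ℤ[[x]]Σ.sumTo n h b ≡ sumTo n (λ i → h i b)
  ℤ[[x]]Σ-sumTo zero    h b = refl
  ℤ[[x]]Σ-sumTo (suc n) h b = ≡.cong (ℤ._+ h (suc n) b) (ℤ[[x]]Σ-sumTo n h b)

  *S≈* : ∀ f g → f *S g ≈ f ℤ[[x]][[q]].* g
  *S≈* f g a b = ≡.sym (≡.trans (ℤ[[x]]Σ-sumTo a (λ i → f i ℤ[[x]].* g (a ∸ i)) b) (sumTo-cong a (λ i → ℤΣ-sumTo b _)))

  oneS≈1 : oneS ≈ ℤ[[x]][[q]].1ₛ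
  oneS≈1 zero    zero    = refl
  oneS≈1 zero    (suc b) = refl
  oneS≈1 (suc a) zero    = refl
  oneS≈1 (suc a) (suc b) = refl

  isCommutativeRing : IsCommutativeRing _≈_ _+S_ _*S_ -S_ zeroS oneS
  isCommutativeRing = record
    { isRing = record
      { +-isAbelianGroup = ℙ.+-isAbelianGroup
      ; *-cong = *-cong
      ; *-assoc = λ f g h → ℙ.trans (*S≈* (f *S g) h) (ℙ.trans (ℙ.*-congʳ {h} (*S≈* f g)) (ℙ.trans (ℙ.*-assoc f g h)
                              (ℙ.trans (ℙ.*-congˡ {f} (ℙ.sym (*S≈* g h))) (ℙ.sym (*S≈* f (g *S h))))))
      ; *-identity = (λ f → ℙ.trans (*S≈* oneS f) (ℙ.trans (ℙ.*-congʳ {f} oneS≈1) (ℙ.*-identityˡ f)))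
                   , (λ f → ℙ.trans (*S≈* f oneS) (ℙ.trans (ℙ.*-congˡ {f} oneS≈1) (ℙ.*-identityʳ f)))
      ; distrib = (λ h f g → ℙ.trans (*S≈* h (f +S g)) (ℙ.trans (ℙ.distribˡ h f g) (ℙ.+-cong (ℙ.sym (*S≈* h f)) (ℙ.sym (*S≈* h g)))))
                , (λ h f g → ℙ.trans (*S≈* (f +S g) h) (ℙ.trans (ℙ.distribʳ h f g) (ℙ.+-cong (ℙ.sym (*S≈* f h)) (ℙ.sym (*S≈* g h))))) }
    ; *-comm = λ f g → ℙ.trans (*S≈* f g) (ℙ.trans (ℙ.*-comm f g) (ℙ.sym (*S≈* g f))) }
    where
    *-cong : ∀ {f f′ g g′} → f ≈ f′ → g ≈ g′ → f *S g ≈ f′ *S g′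
    *-cong {f} {f′} {g} {g′} f≈f′ g≈g′ = ℙ.trans (*S≈* f g) (ℙ.trans (ℙ.*-cong f≈f′ g≈g′) (ℙ.sym (*S≈* f′ g′)))

  seriesRing : CommutativeRing 0ℓ 0ℓ
  seriesRing = record { isCommutativeRing = isCommutativeRing }

  module 𝕊 = CommutativeRing seriesRing
  open import Relation.Binary.Reasoning.Setoid 𝕊.setoid
  open import Algebra.Definitions.RawSemiring (Algebra.Bundles.Semiring.rawSemiring 𝕊.semiring) public using (_^_)
  open import Algebra.Solver.Ring.NaturalCoefficients.Default 𝕊.commutativeSemiring
  private
    module 𝕊-ring = Algebra.Properties.Ring 𝕊.ring
    module ℤ-ring = Algebra.Properties.Ring ℤ.+-*-ring

  sumTo-suc : ∀ n (h : ℕ → ℤ) → sumTo (suc n) h ≡ h 0 ℤ.+ sumTo n (λ i → h (suc i))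
  sumTo-suc n h = ≡.trans (≡.sym (ℤΣ-sumTo (suc n) h))
    (≡.trans (ℤΣ.sumTo-suc n h) (≡.cong (λ t → h 0 ℤ.+ t) (ℤΣ-sumTo n _)))

  sumTo-≡0 : ∀ n (h : ℕ → ℤ) → (∀ i → h i ≡ + 0) → sumTo n h ≡ + 0
  sumTo-≡0 n h h≡0 = ≡.trans (≡.sym (ℤΣ-sumTo n h)) (ℤΣ.sumTo-≈0 n h (λ i _ → h≡0 i))

  mulQpow : ℕ → Series → Series
  mulQpow zero    f = f
  mulQpow (suc e) f zero    b = + 0
  mulQpow (suc e) f (suc a) b = mulQpow e f a b

  mulXpow-cong : ∀ d {f g} → f ≈ g → mulXpow d f ≈ mulXpow d g
  mulXpow-cong zero    f≈g = f≈g
  mulXpow-cong (suc d) f≈g a zero    = refl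
  mulXpow-cong (suc d) f≈g a (suc b) = mulXpow-cong d f≈g a b

  mulQpow-cong : ∀ e {f g} → f ≈ g → mulQpow e f ≈ mulQpow e g
  mulQpow-cong zero    f≈g = f≈g
  mulQpow-cong (suc e) f≈g zero    b = refl
  mulQpow-cong (suc e) f≈g (suc a) b = mulQpow-cong e f≈g a b

  mono-suc-q : ∀ e d a b → mono (suc e) d (suc a) b ≡ mono e d a b
  mono-suc-q e d a b with suc a ≟ suc e | a ≟ e | b ≟ d
  ... | yes _   | yes _   | yes _ = refl
  ... | yes _   | yes _   | no _  = refl
  ... | no _    | no _    | _     = refl
  ... | yes 1+a≡1+e | no a≢e  | _ = contradiction (ℕ.suc-injective 1+a≡1+e) a≢e
  ... | no 1+a≢1+e  | yes a≡e | _ = contradiction (≡.cong suc a≡e) 1+a≢1+e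

  mono-suc-x : ∀ e d a b → mono e (suc d) a (suc b) ≡ mono e d a b
  mono-suc-x e d a b with a ≟ e | suc b ≟ suc d | b ≟ d
  ... | no _  | _     | _     = refl
  ... | yes _ | yes _ | yes _ = refl
  ... | yes _ | no _  | no _  = refl
  ... | yes _ | yes 1+b≡1+d | no b≢d  = contradiction (ℕ.suc-injective 1+b≡1+d) b≢d
  ... | yes _ | no 1+b≢1+d  | yes b≡d = contradiction (≡.cong suc b≡d) 1+b≢1+d

  mono-suc-x-zero : ∀ e d a → mono e (suc d) a zero ≡ + 0
  mono-suc-x-zero e d a with a ≟ e
  ... | yes _ = refl
  ... | no _  = refl

  monoX*≈mulXpow : ∀ d f → mono 0 d *S f ≈ mulXpow d f
  monoX*≈mulXpow zero    f = 𝕊.*-identityˡ f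
  monoX*≈mulXpow (suc d) f a zero    = sumTo-≡0 a _ (λ i → ≡.cong (ℤ._* f (a ∸ i) 0) (mono-suc-x-zero 0 d i))
  monoX*≈mulXpow (suc d) f a (suc b) = ≡.trans (sumTo-cong a inner) (monoX*≈mulXpow d f a b)
    where
    inner : ∀ i → sumTo (suc b) (λ j → mono 0 (suc d) i j ℤ.* f (a ∸ i) (suc b ∸ j))
                ≡ sumTo b (λ j → mono 0 d i j ℤ.* f (a ∸ i) (b ∸ j))
    inner i = ≡.trans (sumTo-suc b _)
      (≡.trans (≡.cong₂ ℤ._+_ (≡.cong (ℤ._* f (a ∸ i) (suc b)) (mono-suc-x-zero 0 d i))
                              (sumTo-cong b (λ j → ≡.cong (ℤ._* f (a ∸ i) (b ∸ j)) (mono-suc-x 0 d i j))))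
               (ℤ.+-identityˡ _))

  mono*≈mulQpow : ∀ e d f → mono e d *S f ≈ mulQpow e (mulXpow d f)
  mono*≈mulQpow zero    d f = monoX*≈mulXpow d f
  mono*≈mulQpow (suc e) d f zero    b = sumTo-≡0 b _ (λ j → refl)
  mono*≈mulQpow (suc e) d f (suc a) b = ≡.trans (sumTo-suc a _)
    (≡.trans (≡.cong₂ ℤ._+_ (sumTo-≡0 b _ (λ j → refl))
                            (sumTo-cong a (λ i → sumTo-cong b (λ j → ≡.cong (ℤ._* f (a ∸ i) (b ∸ j)) (mono-suc-q e d i j)))))
             (≡.trans (ℤ.+-identityˡ _) (mono*≈mulQpow e d f a b)))

  mulXpow-mono : ∀ d e′ d′ → mulXpow d (mono e′ d′) ≈ mono e′ (d ℕ.+ d′)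
  mulXpow-mono zero    e′ d′ a b       = refl
  mulXpow-mono (suc d) e′ d′ a zero    = ≡.sym (mono-suc-x-zero e′ (d ℕ.+ d′) a)
  mulXpow-mono (suc d) e′ d′ a (suc b) = ≡.trans (mulXpow-mono d e′ d′ a b) (≡.sym (mono-suc-x e′ (d ℕ.+ d′) a b))

  mulQpow-mono : ∀ e d e′ d′ → mulQpow e (mulXpow d (mono e′ d′)) ≈ mono (e ℕ.+ e′) (d ℕ.+ d′)
  mulQpow-mono zero    d e′ d′ = mulXpow-mono d e′ d′
  mulQpow-mono (suc e) d e′ d′ zero    b = refl
  mulQpow-mono (suc e) d e′ d′ (suc a) b = ≡.trans (mulQpow-mono e d e′ d′ a b) (≡.sym (mono-suc-q (e ℕ.+ e′) (d ℕ.+ d′) a b))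

  mono-* : ∀ e d e′ d′ → mono e d *S mono e′ d′ ≈ mono (e ℕ.+ e′) (d ℕ.+ d′)
  mono-* e d e′ d′ = 𝕊.trans (mono*≈mulQpow e d (mono e′ d′)) (mulQpow-mono e d e′ d′)

  record IsXFree (s : Series) : Set where
    constructor x-free
    field coefficient≡0 : ∀ a b → s a (suc b) ≡ + 0

  IsXFree-+ : ∀ {s t} → IsXFree s → IsXFree t → IsXFree (s +S t)
  IsXFree-+ (x-free s≡0) (x-free t≡0) = x-free (λ a b → ≡.cong₂ ℤ._+_ (s≡0 a b) (t≡0 a b))

  IsXFree-* : ∀ {s t} → IsXFree s → IsXFree t → IsXFree (s *S t)
  IsXFree-* {s} {t} (x-free s≡0) (x-free t≡0) = x-free λ a b → sumTo-≡0 a _ λ i → ≡.trans (sumTo-suc b _)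
    (≡.cong₂ ℤ._+_ (≡.trans (≡.cong (s i 0 ℤ.*_) (t≡0 (a ∸ i) b)) (ℤ.*-zeroʳ (s i 0)))
                   (sumTo-≡0 b _ (λ j → ≡.cong (ℤ._* t (a ∸ i) (b ∸ j)) (s≡0 i j))))

  IsXFree-mono : ∀ e → IsXFree (mono e 0)
  IsXFree-mono e = x-free monoₑ₀≡0
    where
    monoₑ₀≡0 : ∀ a b → mono e 0 a (suc b) ≡ + 0
    monoₑ₀≡0 a b with a ≟ e
    ... | yes _ = refl
    ... | no _  = refl

  IsXFree-zero : IsXFree zeroS
  IsXFree-zero = x-free (λ a b → refl)

  mulXpow-off : ∀ d s → IsXFree s → ∀ a b → b ≢ d → mulXpow d s a b ≡ + 0
  mulXpow-off zero    s s-free a zero    b≢0 = contradiction refl b≢0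
  mulXpow-off zero    s s-free a (suc b) _   = IsXFree.coefficient≡0 s-free a b
  mulXpow-off (suc d) s s-free a zero    _   = refl
  mulXpow-off (suc d) s s-free a (suc b) b≢d = mulXpow-off d s s-free a b (b≢d ∘ ≡.cong suc)

  mulQpow-≥ : ∀ e f a b → e ≤ a → mulQpow e f a b ≡ f (a ∸ e) b
  mulQpow-≥ zero    f a       b _         = refl
  mulQpow-≥ (suc e) f (suc a) b (s≤s e≤a) = mulQpow-≥ e f a b e≤a

  mulQpow-< : ∀ e f a b → a < e → mulQpow e f a b ≡ + 0
  mulQpow-< (suc e) f zero    b _         = refl
  mulQpow-< (suc e) f (suc a) b (s≤s a<e) = mulQpow-< e f a b a<e

  mulQpow-zero-column : ∀ e f b → (∀ a → f a b ≡ + 0) → ∀ a → mulQpow e f a b ≡ + 0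
  mulQpow-zero-column zero    f b f≡0 a       = f≡0 a
  mulQpow-zero-column (suc e) f b f≡0 zero    = refl
  mulQpow-zero-column (suc e) f b f≡0 (suc a) = mulQpow-zero-column e f b f≡0 a

  substQX-cong : ∀ {f g} → f ≈ g → substQX f ≈ substQX g
  substQX-cong f≈g a b with b ≤? a
  ... | yes _ = f≈g (a ∸ b) b
  ... | no _  = refl

  substQX-mulXpow : ∀ d s → IsXFree s → substQX (mulXpow d s) ≈ mulQpow d (mulXpow d s)
  substQX-mulXpow d s s-free a b with b ≟ d
  ... | yes refl = on-diagonal
    where
    on-diagonal : substQX (mulXpow b s) a b ≡ mulQpow b (mulXpow b s) a b
    on-diagonal with b ≤? a
    ... | yes b≤a = ≡.sym (mulQpow-≥ b _ a b b≤a)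
    ... | no b≰a  = ≡.sym (mulQpow-< b _ a b (ℕ.≰⇒> b≰a))
  ... | no b≢d = ≡.trans off-diagonal (≡.sym (mulQpow-zero-column d _ b (λ a′ → mulXpow-off d s s-free a′ b b≢d) a))
    where
    off-diagonal : substQX (mulXpow d s) a b ≡ + 0
    off-diagonal with b ≤? a
    ... | yes _ = mulXpow-off d s s-free (a ∸ b) b b≢d
    ... | no _  = refl

  qS : Series
  qS = mono 1 0

  1-q*≈ : ∀ F → (oneS -S qS) *S F ≈ F -S mulQpow 1 F
  1-q*≈ F = 𝕊.trans (𝕊.distribʳ F oneS (-S qS))
    (𝕊.+-cong (𝕊.*-identityˡ F) (𝕊.trans (𝕊.sym (𝕊-ring.-‿distribˡ-* qS F)) (𝕊.-‿cong (mono*≈mulQpow 1 0 F))))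

  1-q-cancel : ∀ {F G} → (oneS -S qS) *S F ≈ (oneS -S qS) *S G → F ≈ G
  1-q-cancel {F} {G} eq = go
    where
    diff : ∀ a b → F a b ℤ.+ ℤ.- mulQpow 1 F a b ≡ G a b ℤ.+ ℤ.- mulQpow 1 G a b
    diff a b = ≡.trans (≡.sym (1-q*≈ F a b)) (≡.trans (eq a b) (1-q*≈ G a b))
    go : F ≈ G
    go zero    b = ℤ-ring.+-cancelʳ (+ 0) _ _ (diff 0 b)
    go (suc a) b = ℤ-ring.+-cancelʳ _ _ _ (≡.trans (diff (suc a) b) (≡.cong (λ t → G (suc a) b ℤ.+ ℤ.- t) (≡.sym (go a b))))

  -- Exact, although D divides by x: f and f(qx) have the same x⁰-coefficient.
  1-q*xD : ∀ f → (oneS -S qS) *S mulX (qD f) ≈ f -S substQX f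
  1-q*xD f = 𝕊.trans (1-q*≈ (mulX (qD f))) coefficients
    where
    g = f -S substQX f
    column : ℕ → ℕ → ℤ
    column a b = sumTo a (λ i → g (a ∸ i) (suc b))
    xD-coefficient : ∀ a b → mulX (qD f) a (suc b) ≡ column a b
    xD-coefficient a b = sumTo-cong a λ i → ≡.trans (sumTo-suc b _)
      (≡.trans (≡.cong₂ ℤ._+_ (ℤ.*-identityˡ (g (a ∸ i) (suc b))) (sumTo-≡0 b _ (λ j → refl))) (ℤ.+-identityʳ _))
    coefficients : mulX (qD f) -S mulQpow 1 (mulX (qD f)) ≈ g
    coefficients zero zero with 0 ≤? 0
    ... | yes _  = ≡.sym (ℤ.+-inverseʳ (f 0 0))
    ... | no 0≰0 = contradiction z≤n 0≰0
    coefficients (suc a) zero with 0 ≤? suc a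
    ... | yes _  = ≡.sym (ℤ.+-inverseʳ (f (suc a) 0))
    ... | no 0≰a = contradiction z≤n 0≰a
    coefficients zero (suc b) = ≡.trans (≡.cong (ℤ._+ + 0) (xD-coefficient 0 b)) (ℤ.+-identityʳ _)
    coefficients (suc a) (suc b) =
      ≡.trans (≡.cong₂ (λ u v → u ℤ.+ ℤ.- v) (xD-coefficient (suc a) b) (xD-coefficient a b))
              (≡.trans (≡.cong (λ u → u ℤ.+ ℤ.- column a b) (sumTo-suc a _)) (ℤ-ring.//-rightDividesʳ (column a b) (g (suc a) (suc b))))

  x+y≈1⇒x≈1-y : ∀ {f g} → f +S g ≈ oneS → f ≈ oneS -S g
  x+y≈1⇒x≈1-y {f} {g} f+g≈1 = 𝕊.trans (𝕊.sym (𝕊-ring.//-rightDividesʳ g f)) (𝕊.+-congʳ { -S g} f+g≈1)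

  xD-monomial : ∀ d s W → IsXFree s → ((oneS -S qS) *S W) +S mono d 0 ≈ oneS →
    mulX (qD (s *S mono 0 d)) ≈ (s *S W) *S mono 0 d
  xD-monomial d s W s-free geometric = 1-q-cancel (begin
    (oneS -S qS) *S mulX (qD f)          ≈⟨ 1-q*xD f ⟩
    f -S substQX f                        ≈⟨ 𝕊.+-congˡ {f} (𝕊.-‿cong substQX-f≈P*f) ⟩
    f -S (P *S f)                         ≈⟨ 𝕊.+-cong (𝕊.*-identityˡ f) (𝕊.sym (𝕊-ring.-‿distribˡ-* P f)) ⟨
    (oneS *S f) +S ((-S P) *S f)          ≈⟨ 𝕊.distribʳ f oneS (-S P) ⟨
    (oneS -S P) *S f                      ≈⟨ 𝕊.*-congʳ {f} 1-P≈[1-q]W ⟩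
    ((oneS -S qS) *S W) *S (s *S Y)       ≈⟨ solve 4 (λ o w s y → (o :* w) :* (s :* y) := o :* ((s :* w) :* y)) 𝕊.refl (oneS -S qS) W s Y ⟩
    (oneS -S qS) *S ((s *S W) *S Y)       ∎)
    where
    Y P f : Series
    Y = mono 0 d
    P = mono d 0
    f = s *S Y
    P*Y≈mono : P *S Y ≈ mono d d
    P*Y≈mono = ≡.subst (λ t → P *S Y ≈ mono t d) (ℕ.+-identityʳ d) (mono-* d 0 0 d)
    substQX-f≈P*f : substQX f ≈ P *S f
    substQX-f≈P*f = begin
      substQX (s *S Y)              ≈⟨ substQX-cong (𝕊.trans (𝕊.*-comm s Y) (monoX*≈mulXpow d s)) ⟩
      substQX (mulXpow d s)         ≈⟨ substQX-mulXpow d s s-free ⟩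
      mulQpow d (mulXpow d s)       ≈⟨ mono*≈mulQpow d d s ⟨
      mono d d *S s                 ≈⟨ 𝕊.*-congʳ {s} P*Y≈mono ⟨
      (P *S Y) *S s                 ≈⟨ solve 3 (λ p y s → (p :* y) :* s := p :* (s :* y)) 𝕊.refl P Y s ⟩
      P *S (s *S Y)                 ∎
    1-P≈[1-q]W : oneS -S P ≈ (oneS -S qS) *S W
    1-P≈[1-q]W = 𝕊.sym (x+y≈1⇒x≈1-y geometric)

  mulXpow-+ : ∀ d f g → mulXpow d (f +S g) ≈ mulXpow d f +S mulXpow d g
  mulXpow-+ zero    f g a b       = refl
  mulXpow-+ (suc d) f g a zero    = refl
  mulXpow-+ (suc d) f g a (suc b) = mulXpow-+ d f g a b

  substQX-+ : ∀ f g → substQX (f +S g) ≈ substQX f +S substQX g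
  substQX-+ f g a b with b ≤? a
  ... | yes _ = refl
  ... | no _  = refl

  qD-cong : ∀ {f g} → f ≈ g → qD f ≈ qD g
  qD-cong {f} {g} f≈g a b = 𝕊.*-congˡ {geomQ} (𝕊.+-cong f≈g (𝕊.-‿cong (substQX-cong f≈g))) a (suc b)

  qD-+ : ∀ f g → qD (f +S g) ≈ qD f +S qD g
  qD-+ f g a b = 𝕊.trans (𝕊.*-congˡ {geomQ} regroup) (𝕊.distribˡ geomQ (f -S substQX f) (g -S substQX g)) a (suc b)
    where
    regroup : (f +S g) -S substQX (f +S g) ≈ (f -S substQX f) +S (g -S substQX g)
    regroup = begin
      (f +S g) +S (-S substQX (f +S g))             ≈⟨ 𝕊.+-congˡ {f +S g} (𝕊.-‿cong (substQX-+ f g)) ⟩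
      (f +S g) +S (-S (substQX f +S substQX g))     ≈⟨ 𝕊.+-congˡ {f +S g} (𝕊.sym (𝕊-ring.-‿+-comm (substQX f) (substQX g))) ⟩
      (f +S g) +S ((-S substQX f) +S (-S substQX g)) ≈⟨ solve 4 (λ f g u v → (f :+ g) :+ (u :+ v) := (f :+ u) :+ (g :+ v)) 𝕊.refl
                                                          f g (-S substQX f) (-S substQX g) ⟩
      (f -S substQX f) +S (g -S substQX g)          ∎

  opψ-cong : ∀ c {f g} → f ≈ g → opψ c f ≈ opψ c g
  opψ-cong c f≈g = 𝕊.+-cong (mulXpow-cong c f≈g) (mulXpow-cong 1 (qD-cong f≈g))

  opψ-+ : ∀ c f g → opψ c (f +S g) ≈ opψ c f +S opψ c g
  opψ-+ c f g = 𝕊.trans (𝕊.+-cong (mulXpow-+ c f g) (𝕊.trans (mulXpow-cong 1 (qD-+ f g)) (mulXpow-+ 1 (qD f) (qD g))))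
    (solve 4 (λ a b u v → (a :+ b) :+ (u :+ v) := (a :+ u) :+ (b :+ v)) 𝕊.refl
       (mulXpow c f) (mulXpow c g) (mulX (qD f)) (mulX (qD g)))

  mono-^ : ∀ e d m → mono e d ^ m ≈ mono (m ℕ.* e) (m ℕ.* d)
  mono-^ e d zero    = 𝕊.refl
  mono-^ e d (suc m) = 𝕊.trans (𝕊.*-congˡ {mono e d} (mono-^ e d m)) (mono-* e d (m ℕ.* e) (m ℕ.* d))

  IsXFree-[] : ∀ {r} → IsXFree r → ∀ m → IsXFree (QInteger.[_] seriesRing r m)
  IsXFree-[] r-free zero    = IsXFree-zero
  IsXFree-[] r-free (suc m) = IsXFree-+ (IsXFree-mono 0) (IsXFree-* r-free (IsXFree-[] r-free m))

module HankelRatio (c : ℕ) where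
  open import Data.Nat as ℕ using (ℕ; zero; suc)
  open BivariateSeries
  import Data.Nat.Properties as ℕ
  open import Data.Nat.Combinatorics using (_C_)
  open import Data.Integer as ℤ using (ℤ; +_)
  open import Data.Fin using (Fin; toℕ; punchIn) renaming (zero to fzero; suc to fsuc)
  open import Relation.Binary.PropositionalEquality as ≡ using (_≡_; refl)
  import Algebra.Properties.Ring
  open import Relation.Binary.Reasoning.Setoid 𝕊.setoid
  open import Algebra.Solver.Ring.NaturalCoefficients.Default 𝕊.commutativeSemiring

  y p w : Series
  y = mono 0 c
  p = mono c 0
  w = QInteger.[_] seriesRing qS c

  open QInteger seriesRing p using ([_]; [_]-geometric)
  open MotzkinMoments seriesRing y p using (pascal; module Weighted)
  open Products seriesRing using (product; product-cong; product-distrib-*; product-const; product-^)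
  open import Algebra.Properties.Semiring.Sum 𝕊.semiring using (sum)
  module Σ = RangeSum seriesRing
  module Det = Determinant seriesRing
  module ψ₀ = Weighted zeroS w oneS
  module ψ₁ = Weighted w (p *S w) y
  private
    module 𝕊-ring = Algebra.Properties.Ring 𝕊.ring

  p^m≈mono : ∀ m → p ^ m ≈ mono (m ℕ.* c) 0
  p^m≈mono m = ≡.subst (λ t → p ^ m ≈ mono (m ℕ.* c) t) (ℕ.*-zeroʳ m) (mono-^ c 0 m)

  pascal-zero : ∀ m → pascal m 0 ≈ mono 0 (m ℕ.* c)
  pascal-zero zero    = 𝕊.refl
  pascal-zero (suc m) = 𝕊.trans (𝕊.*-congˡ {y} (pascal-zero m)) (mono-* 0 c 0 (m ℕ.* c))

  [1-q]w≈1-p : (oneS -S qS) *S w ≈ oneS -S p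
  [1-q]w≈1-p = x+y≈1⇒x≈1-y (𝕊.trans (𝕊.+-congˡ {(oneS -S qS) *S w} (𝕊.sym q^c≈p)) (QInteger.[_]-geometric seriesRing qS c))
    where
    q^c≈p : qS ^ c ≈ p
    q^c≈p = ≡.subst₂ (λ e d → qS ^ c ≈ mono e d) (ℕ.*-identityʳ c) (ℕ.*-zeroʳ c) (mono-^ 1 0 c)

  -- weight₀ m = [m c]_q, since (1-q)[c]_q = 1 - q^c.
  weight₀-geometric : ∀ m → ((oneS -S qS) *S ψ₀.weight m) +S mono (m ℕ.* c) 0 ≈ oneS
  weight₀-geometric m = begin
    ((oneS -S qS) *S (zeroS +S (w *S [ m ]))) +S mono (m ℕ.* c) 0
      ≈⟨ 𝕊.+-cong (𝕊.trans (𝕊.*-congˡ {oneS -S qS} (𝕊.+-identityˡ (w *S [ m ]))) (𝕊.sym (𝕊.*-assoc (oneS -S qS) w [ m ])))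
                  (𝕊.sym (p^m≈mono m)) ⟩
    (((oneS -S qS) *S w) *S [ m ]) +S (p ^ m)
      ≈⟨ 𝕊.+-congʳ {p ^ m} (𝕊.*-congʳ {[ m ]} [1-q]w≈1-p) ⟩
    ((oneS -S p) *S [ m ]) +S (p ^ m)
      ≈⟨ [ m ]-geometric ⟩
    oneS ∎

  IsXFree-weight₀ : ∀ m → IsXFree (ψ₀.weight m)
  IsXFree-weight₀ m = IsXFree-+ IsXFree-zero (IsXFree-* (IsXFree-[] (IsXFree-mono 1) c) (IsXFree-[] (IsXFree-mono c) m))

  IsXFree-stirling₀ : ∀ i m → IsXFree (ψ₀.stirling i m)
  IsXFree-stirling₀ zero    zero    = IsXFree-mono 0
  IsXFree-stirling₀ zero    (suc m) = IsXFree-zero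
  IsXFree-stirling₀ (suc i) zero    = IsXFree-* (IsXFree-weight₀ 0) (IsXFree-stirling₀ i 0)
  IsXFree-stirling₀ (suc i) (suc m) =
    IsXFree-+ (IsXFree-stirling₀ i m) (IsXFree-* (IsXFree-weight₀ (suc m)) (IsXFree-stirling₀ i (suc m)))

  opψ-pascal : ∀ s m → IsXFree s →
    opψ c (s *S pascal m 0) ≈ s *S (pascal (suc m) 0 +S (ψ₀.weight m *S pascal m 0))
  opψ-pascal s m s-free = begin
    mulXpow c (s *S B) +S mulX (qD (s *S B))
      ≈⟨ 𝕊.+-cong (𝕊.sym (monoX*≈mulXpow c (s *S B))) (mulXpow-cong 1 (qD-cong (𝕊.*-congˡ {s} (pascal-zero m)))) ⟩
    (y *S (s *S B)) +S mulX (qD (s *S mono 0 (m ℕ.* c)))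
      ≈⟨ 𝕊.+-congˡ {y *S (s *S B)} (𝕊.trans (xD-monomial (m ℕ.* c) s W s-free (weight₀-geometric m))
                                              (𝕊.*-congˡ {s *S W} (𝕊.sym (pascal-zero m)))) ⟩
    (y *S (s *S B)) +S ((s *S W) *S B)
      ≈⟨ solve 4 (λ y s b w → y :* (s :* b) :+ (s :* w) :* b := s :* (y :* b :+ w :* b)) 𝕊.refl y s B W ⟩
    s *S ((y *S B) +S (W *S B)) ∎
    where
    B W : Series
    B = pascal m 0
    W = ψ₀.weight m

  opψ-sumTo : ∀ i (h : ℕ → Series) → opψ c (Σ.sumTo i h) ≈ Σ.sumTo i (λ m → opψ c (h m))
  opψ-sumTo zero    h = 𝕊.refl
  opψ-sumTo (suc i) h = 𝕊.trans (opψ-+ c (Σ.sumTo i h) (h (suc i))) (𝕊.+-congʳ {opψ c (h (suc i))} (opψ-sumTo i h))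

  ψ≈motzkin₀ : ∀ i → ψ i c ≈ ψ₀.motzkin i 0
  ψ≈motzkin₀ zero    = 𝕊.sym (𝕊.*-identityˡ oneS)
  ψ≈motzkin₀ (suc i) = begin
    opψ c (ψ i c)
      ≈⟨ opψ-cong c (ψ≈motzkin₀ i) ⟩
    opψ c (Σ.sumTo i (λ m → ψ₀.stirling i m *S pascal m 0))
      ≈⟨ opψ-sumTo i (λ m → ψ₀.stirling i m *S pascal m 0) ⟩
    Σ.sumTo i (λ m → opψ c (ψ₀.stirling i m *S pascal m 0))
      ≈⟨ Σ.sumTo-cong i (λ m → opψ-pascal (ψ₀.stirling i m) m (IsXFree-stirling₀ i m)) ⟩
    Σ.sumTo i (λ m → ψ₀.stirling i m *S (pascal (suc m) 0 +S (ψ₀.weight m *S pascal m 0)))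
      ≈⟨ ψ₀.sumTo-stirling-suc i (λ m → pascal m 0) ⟨
    ψ₀.motzkin (suc i) 0 ∎

  weight₀-suc : ∀ m → ψ₀.weight (suc m) ≈ ψ₁.weight m
  weight₀-suc m = solve 3 (λ w p n → con 0 :+ w :* (con 1 :+ p :* n) := w :+ (p :* w) :* n) 𝕊.refl w p [ m ]

  stirling₀-suc-zero : ∀ i → ψ₀.stirling (suc i) 0 ≈ zeroS
  stirling₀-suc-zero i = 𝕊.trans (𝕊.*-congʳ {ψ₀.stirling i 0} (𝕊.trans (𝕊.+-identityˡ (w *S zeroS)) (𝕊.zeroʳ w)))
                                 (𝕊.zeroˡ (ψ₀.stirling i 0))

  stirling₀-suc : ∀ i m → ψ₀.stirling (suc i) (suc m) ≈ ψ₁.stirling i m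
  stirling₀-suc zero    zero    = 𝕊.trans (𝕊.+-congˡ {oneS} (𝕊.zeroʳ (ψ₀.weight 1))) (𝕊.+-identityʳ oneS)
  stirling₀-suc zero    (suc m) = 𝕊.trans (𝕊.+-congˡ {zeroS} (𝕊.zeroʳ (ψ₀.weight (suc (suc m))))) (𝕊.+-identityʳ zeroS)
  stirling₀-suc (suc i) zero    =
    𝕊.trans (𝕊.+-cong (stirling₀-suc-zero i) (𝕊.*-cong (weight₀-suc 0) (stirling₀-suc i 0))) (𝕊.+-identityˡ _)
  stirling₀-suc (suc i) (suc m) =
    𝕊.+-cong (stirling₀-suc i m) (𝕊.*-cong (weight₀-suc (suc m)) (stirling₀-suc i (suc m)))

  ψ-suc≈motzkin₁ : ∀ i → ψ (suc i) c ≈ ψ₁.motzkin i 0 *S y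
  ψ-suc≈motzkin₁ i = begin
    ψ (suc i) c
      ≈⟨ ψ≈motzkin₀ (suc i) ⟩
    Σ.sumTo (suc i) (λ m → ψ₀.stirling (suc i) m *S pascal m 0)
      ≈⟨ Σ.sumTo-suc i _ ⟩
    (ψ₀.stirling (suc i) 0 *S oneS) +S Σ.sumTo i (λ m → ψ₀.stirling (suc i) (suc m) *S (y *S pascal m 0))
      ≈⟨ 𝕊.+-cong (𝕊.trans (𝕊.*-congʳ {oneS} (stirling₀-suc-zero i)) (𝕊.zeroˡ oneS))
                  (Σ.sumTo-cong i (λ m → 𝕊.*-congʳ {y *S pascal m 0} (stirling₀-suc i m))) ⟩
    zeroS +S Σ.sumTo i (λ m → ψ₁.stirling i m *S (y *S pascal m 0))
      ≈⟨ 𝕊.+-identityˡ _ ⟩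
    Σ.sumTo i (λ m → ψ₁.stirling i m *S (y *S pascal m 0))
      ≈⟨ Σ.sumTo-cong i (λ m → solve 3 (λ s y b → s :* (y :* b) := (s :* b) :* y) 𝕊.refl (ψ₁.stirling i m) y (pascal m 0)) ⟩
    Σ.sumTo i (λ m → (ψ₁.stirling i m *S pascal m 0) *S y)
      ≈⟨ Σ.*-distribʳ-sumTo i y _ ⟨
    ψ₁.motzkin i 0 *S y ∎

  pivot₁ : ∀ k → ψ₁.pivot k ≈ (y *S (p ^ k)) *S ψ₀.pivot k
  pivot₁ zero    = solve 1 (λ y → y := (y :* con 1) :* con 1) 𝕊.refl y
  pivot₁ (suc k) = begin
    ψ₁.Λ k *S ψ₁.pivot k
      ≈⟨ 𝕊.*-congˡ {ψ₁.Λ k} (pivot₁ k) ⟩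
    (((y *S (p ^ k)) *S (p *S w)) *S [ suc k ]) *S ((y *S (p ^ k)) *S ψ₀.pivot k)
      ≈⟨ solve 6 (λ y q p w n d → (((y :* q) :* (p :* w)) :* n) :* ((y :* q) :* d) := (y :* (p :* q)) :* ((((y :* q) :* w) :* n) :* d))
           𝕊.refl y (p ^ k) p w [ suc k ] (ψ₀.pivot k) ⟩
    (y *S (p ^ suc k)) *S ψ₀.pivot (suc k) ∎

  signS≈sign : ∀ k s → signS k s ≈ Det.sign k *S s
  signS≈sign zero          s = 𝕊.sym (𝕊.*-identityˡ s)
  signS≈sign (suc zero)    s = 𝕊.sym (𝕊-ring.-1*x≈-x s)
  signS≈sign (suc (suc k)) s = 𝕊.trans (signS≈sign k s) (𝕊.*-congʳ {s} (𝕊.sym (𝕊-ring.-‿involutive (Det.sign k))))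

  sumFin≈sum : ∀ n {h h′ : Fin n → Series} → (∀ j → h j ≈ h′ j) → sumFin n h ≈ sum h′
  sumFin≈sum zero    h≈h′ = 𝕊.refl
  sumFin≈sum (suc n) h≈h′ = 𝕊.+-cong (h≈h′ fzero) (sumFin≈sum n (λ j → h≈h′ (fsuc j)))

  det≈Det : ∀ n (M : Fin n → Fin n → Series) → det n M ≈ Det.det n M
  det≈Det zero    M = 𝕊.refl
  det≈Det (suc n) M = sumFin≈sum (suc n) λ j →
    𝕊.trans (signS≈sign (toℕ j) (M fzero j *S det n (λ i k → M (fsuc i) (punchIn j k))))
            (𝕊.*-congˡ {Det.sign (toℕ j)} (𝕊.*-congˡ {M fzero j} (det≈Det n (λ i k → M (fsuc i) (punchIn j k)))))

  x+x≈0⇒x≈0 : ∀ f → f +S f ≈ zeroS → f ≈ zeroS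
  x+x≈0⇒x≈0 f f+f≈0 a b = z+z≡0⇒z≡0 (f a b) (f+f≈0 a b)
    where
    z+z≡0⇒z≡0 : ∀ z → z ℤ.+ z ≡ + 0 → z ≡ + 0
    z+z≡0⇒z≡0 (+ zero)   _  = refl
    z+z≡0⇒z≡0 (+ suc n)  ()
    z+z≡0⇒z≡0 ℤ.-[1+ n ] ()

  y^n*p^C≈mono : ∀ n → (y ^ n) *S (p ^ (n C 2)) ≈ mono (c ℕ.* (n C 2)) (n ℕ.* c)
  y^n*p^C≈mono n = 𝕊.trans (𝕊.*-cong (mono-^ 0 c n) (p^m≈mono (n C 2)))
    (𝕊.trans (mono-* (n ℕ.* 0) (n ℕ.* c) ((n C 2) ℕ.* c) 0)
             (𝕊.reflexive (≡.cong₂ mono (≡.trans (≡.cong (ℕ._+ (n C 2) ℕ.* c) (ℕ.*-zeroʳ n)) (ℕ.*-comm (n C 2) c))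
                                        (ℕ.+-identityʳ (n ℕ.* c)))))

  hankel-ratio : ∀ n → det n (λ i j → ψ (suc (toℕ i ℕ.+ toℕ j)) c)
                       ≈ mono (c ℕ.* (n C 2)) (n ℕ.* c) *S det n (λ i j → ψ (toℕ i ℕ.+ toℕ j) c)
  hankel-ratio n = begin
    det n (λ i j → ψ (suc (toℕ i ℕ.+ toℕ j)) c)
      ≈⟨ det≈Det n _ ⟩
    Det.det n (λ i j → ψ (suc (toℕ i ℕ.+ toℕ j)) c)
      ≈⟨ Det.det-cong n (λ i j → ψ-suc≈motzkin₁ (toℕ i ℕ.+ toℕ j)) ⟩
    Det.det n (λ i j → ψ₁.motzkin (toℕ i ℕ.+ toℕ j) 0 *S y)
      ≈⟨ ψ₁.det-hankel x+x≈0⇒x≈0 n ⟩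
    product {n} (λ k → ψ₁.pivot (toℕ k))
      ≈⟨ product-cong {n} (λ k → pivot₁ (toℕ k)) ⟩
    product {n} (λ k → (y *S (p ^ toℕ k)) *S ψ₀.pivot (toℕ k))
      ≈⟨ 𝕊.trans (product-distrib-* {n} (λ k → y *S (p ^ toℕ k)) (λ k → ψ₀.pivot (toℕ k)))
                 (𝕊.*-congʳ {product {n} (λ k → ψ₀.pivot (toℕ k))} (product-distrib-* {n} (λ _ → y) (λ k → p ^ toℕ k))) ⟩
    (product {n} (λ _ → y) *S product {n} (λ k → p ^ toℕ k)) *S product {n} (λ k → ψ₀.pivot (toℕ k))
      ≈⟨ 𝕊.*-cong (𝕊.trans (𝕊.*-cong (product-const n y) (product-^ n p)) (y^n*p^C≈mono n)) (𝕊.sym (ψ₀.det-hankel x+x≈0⇒x≈0 n)) ⟩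
    mono (c ℕ.* (n C 2)) (n ℕ.* c) *S Det.det n (λ i j → ψ₀.motzkin (toℕ i ℕ.+ toℕ j) 0 *S oneS)
      ≈⟨ 𝕊.*-congˡ {mono (c ℕ.* (n C 2)) (n ℕ.* c)}
           (Det.det-cong n (λ i j → 𝕊.trans (𝕊.*-identityʳ _) (𝕊.sym (ψ≈motzkin₀ (toℕ i ℕ.+ toℕ j))))) ⟩
    mono (c ℕ.* (n C 2)) (n ℕ.* c) *S Det.det n (λ i j → ψ (toℕ i ℕ.+ toℕ j) c)
      ≈⟨ 𝕊.*-congˡ {mono (c ℕ.* (n C 2)) (n ℕ.* c)} (det≈Det n _) ⟨
    mono (c ℕ.* (n C 2)) (n ℕ.* c) *S det n (λ i j → ψ (toℕ i ℕ.+ toℕ j) c) ∎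

mainTheorem5 : (c : ℕ) → 1 ≤ c → (n : ℕ) → 1 ≤ n →
    det n (λ i j → ψ (suc (toℕ i + toℕ j)) c)
      ≈ mono (c * (n C 2)) (n * c) *S det n (λ i j → ψ (toℕ i + toℕ j) c)
mainTheorem5 c _ n _ = HankelRatio.hankel-ratio c n
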